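{- There exists a constant $C>0$ such that for every $\mathbf{a}\in\mathbb{L}^{\mathrm{loc}}$ and every sufficiently large $B$, $\mathfrak{S}_{\mathbf{a}}(B)\geq C>0$.
   Context: $\mathbb{Z}^4_{\mathrm{prim}}$ is the set of tuples $\mathbf{a}=(a_1,\dots,a_4)$ of non-zero integers with gcd $1$; $\mathbb{L}^{\mathrm{loc}}$ is the set of $\mathbf{a}\in\mathbb{Z}^4_{\mathrm{prim}}$ whose coordinates are not all of the same sign and such that for every prime $p$ there exist integers $x_1,\dots,x_4$, none divisible by $p$, with $a_1x_1+\dots+a_4x_4\equiv0\pmod p$. Set $w=\log\log B/\log\log\log B$ and $W=\prod_{p\leq w}p^{\lceil\log w/\log p\rceil+1}$ (over primes). For an integer $Q\geq1$, $\sigma(\mathbf{a},Q)=\frac{Q}{\phi(Q)^4}\#\{\mathbf{b}\in((\mathbb{Z}/Q\mathbb{Z})^*)^4:a_1b_1+\dots+a_4b_4\equiv0\pmod Q\}$, and $\mathfrak{S}_{\mathbf{a}}(B)=\sigma(\mathbf{a},W)$. -}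

module Defs where

open import Data.Nat as ℕ using (ℕ; zero; suc; _^_; _≤_; _≤?_)
open import Data.Nat.GCD using (gcd)
open import Data.Nat.Coprimality using (coprime?)
open import Data.Nat.Primality using (Prime; prime?)
open import Data.Nat.Divisibility using (_∣?_)
open import Data.Integer as ℤ using (ℤ; +_; ∣_∣)
import Data.Integer.Divisibility as ℤD
open import Data.Rational as ℚ using (ℚ; 0ℚ)
open import Data.Fin using (Fin; zero; suc)
open import Data.Nat.ListAction using (product)
open import Data.List using (List; []; _∷_; filter; upTo; length; map; foldr; concatMap; head)
open import Data.Maybe using (fromMaybe)
open import Data.Product using (_×_; Σ; _,_)
open import Data.Sum using (_⊎_)
open import Relation.Binary.PropositionalEquality using (_≡_; _≢_)
open import Relation.Nullary using (¬_)

Vec4 : Set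
Vec4 = Fin 4 → ℤ

dot : Vec4 → Vec4 → ℤ
dot a x = a zero ℤ.* x zero ℤ.+ (a (suc zero) ℤ.* x (suc zero)
        ℤ.+ (a (suc (suc zero)) ℤ.* x (suc (suc zero))
        ℤ.+ a (suc (suc (suc zero))) ℤ.* x (suc (suc (suc zero)))))

gcd4 : Vec4 → ℕ
gcd4 a = gcd ∣ a zero ∣ (gcd ∣ a (suc zero) ∣ (gcd ∣ a (suc (suc zero)) ∣ ∣ a (suc (suc (suc zero))) ∣))

Prim : Vec4 → Set
Prim a = ((i : Fin 4) → a i ≢ + 0) × gcd4 a ≡ 1

AllSameSign : Vec4 → Set
AllSameSign a = ((i : Fin 4) → + 0 ℤ.< a i) ⊎ ((i : Fin 4) → a i ℤ.< + 0)

LocalAt : ℕ → Vec4 → Set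
LocalAt p a = Σ Vec4 λ x → ((i : Fin 4) → ¬ (+ p ℤD.∣ x i)) × (+ p ℤD.∣ dot a x)

Lloc : Vec4 → Set
Lloc a = Prim a × (¬ AllSameSign a) × ((p : ℕ) → Prime p → LocalAt p a)

-- (ℤ/Qℤ)* represented by residues 0 ≤ b < Q coprime to Q
units : ℕ → List ℕ
units Q = filter (λ b → coprime? b Q) (upTo Q)

φ : ℕ → ℕ
φ Q = length (units Q)

tuple4 : ℕ → ℕ → ℕ → ℕ → Vec4
tuple4 b₁ b₂ b₃ b₄ zero = + b₁
tuple4 b₁ b₂ b₃ b₄ (suc zero) = + b₂
tuple4 b₁ b₂ b₃ b₄ (suc (suc zero)) = + b₃
tuple4 b₁ b₂ b₃ b₄ (suc (suc (suc zero))) = + b₄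

unitTuples : ℕ → List Vec4
unitTuples Q =
  concatMap (λ b₁ → concatMap (λ b₂ → concatMap (λ b₃ → map (λ b₄ → tuple4 b₁ b₂ b₃ b₄)
    (units Q)) (units Q)) (units Q)) (units Q)

-- #{ b ∈ ((ℤ/Qℤ)*)⁴ : a·b ≡ 0 mod Q }   (Q ∣ a·b in ℤ, i.e. Q ∣ |a·b| in ℕ)
solCount : Vec4 → ℕ → ℕ
solCount a Q = length (filter (λ b → Q ∣? ∣ dot a b ∣) (unitTuples Q))

-- n / d as a rational, with the (never used for Q ≥ 1) convention n / 0 = 0
frac : ℤ → ℕ → ℚ
frac n zero = 0ℚ
frac n (suc d) = n ℚ./ suc d

σ : Vec4 → ℕ → ℚ
σ a Q = frac (+ (Q ℕ.* solCount a Q)) (φ Q ^ 4)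

-- least k with m ≤ p^k (= ⌈log w / log p⌉ for the relevant m);
-- for p ≥ 2 such k ≤ m always exists
ceilLog : ℕ → ℕ → ℕ
ceilLog p m = fromMaybe m (head (filter (λ k → m ≤? p ^ k) (upTo (suc m))))

primesUpTo : ℕ → List ℕ
primesUpTo n = filter prime? (upTo (suc n))

-- W for a real w with ⌊w⌋ = n and ⌈w⌉ = m :
-- ∏_{p ≤ w} p^(⌈log w / log p⌉ + 1)
Wfun : ℕ → ℕ → ℕ
Wfun n m = product (map (λ p → p ^ (ceilLog p m ℕ.+ 1)) (primesUpTo n))

-- σ(a, Q) is multiplicative in Q (Chinese remainder theorem), so σ(a, W) is the product of the
-- factors σ(a, p^k), k ≥ 1, over the primes p ≤ w. As gcd(a) = 1, some coordinate is a unit mod p;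
-- summing it out shows that the number N(p^k) of unit solutions mod p^k is p^{3(k-1)} N(p), so
-- σ(a, p^k) = p N(p) / (p - 1)⁴ whatever k is. An explicit count shows N(p) ≥ (p - 2)(p - 1)²
-- as soon as N(p) ≥ 1, which local solubility provides. Hence σ(a, 2^k) ≥ 2 and
-- σ(a, p^k) ≥ 1 - 1/(p - 1)² for p ≥ 3, and the product over 3 ≤ p ≤ n is at least
-- ∏_{m=2}^{n-1} (1 - 1/m²) = n / (2(n - 1)) > 1/2.

module Submission where

open import Defs
open import Level using (Level)
open import Function using (_∘_)
open import Data.Empty using (⊥-elim)
open import Data.Product using (Σ; _×_; _,_; proj₁; proj₂)
open import Data.Sum using (_⊎_; inj₁; inj₂)
open import Relation.Nullary using (¬_; Dec; yes; no)
open import Relation.Nullary.Decidable using (¬?)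
open import Relation.Binary.PropositionalEquality
  using (_≡_; refl; sym; trans; cong; cong₂; subst; subst₂; module ≡-Reasoning)
open import Data.Nat as ℕ
  using (ℕ; zero; suc; _+_; _*_; _∸_; _^_; _≤_; _<_; z≤n; s≤s; NonZero; _≟_)
open import Data.Nat.Properties
open import Data.Nat.DivMod using (_%_; _/_; m≡m%n+[m/n]*n; [m+kn]%n≡m%n; m<n⇒m%n≡m; %-congˡ; m%n<n)
open import Data.Nat.Divisibility as ℕ∣ using (_∣_; _∣?_; divides; >⇒∤)
open import Data.Nat.Coprimality as Coprime using (Coprime; coprime?; coprime-divisor)
open import Data.Nat.GCD using (gcd-greatest)
open import Data.Nat.Primality
  using (Prime; prime?; euclidsLemma; prime⇒irreducible; prime⇒nonZero; prime⇒nonTrivial; ¬prime[0]; ¬prime[1]; prime[2])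
open import Data.Nat.ListAction using (product)
open import Data.Nat.ListAction.Properties using (product-++)
import Data.Nat.Tactic.RingSolver as ℕ-Solver
open import Data.Integer as ℤ using (ℤ; +_; ∣_∣)
import Data.Integer.Properties as ℤ
import Data.Integer.Divisibility.Signed as ℤ∣ˢ
open import Data.Integer.DivMod using (a≡a%ℕn+[a/ℕn]*n; n%ℕd<d)
import Data.Integer.Tactic.RingSolver as ℤ-Solver
open import Data.Rational as ℚ using (ℚ; 0ℚ; ½)
open import Data.Rational.Properties using (toℚᵘ-cancel-≤; toℚᵘ-fromℚᵘ)
open import Data.Rational.Unnormalised as ℚᵘ using (mkℚᵘ; *≤*)
import Data.Rational.Unnormalised.Properties as ℚᵘ
open import Data.Fin as Fin using (Fin)
open import Data.List using (List; []; _∷_; _++_; [_]; filter; upTo; length; map; concatMap)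
open import Data.List.Properties using (length-++; filter-++; upTo-∷ʳ; filter-accept; filter-reject; map-++)
open import Algebra.Properties.CommutativeSemigroup +-commutativeSemigroup using ()
  renaming (interchange to +-interchange)
open import Algebra.Properties.CommutativeSemigroup *-commutativeSemigroup using ()
  renaming (interchange to *-interchange; x∙yz≈y∙xz to *-left-comm)

private variable
  ℓ : Level
  P P′ P″ : Set ℓ

𝟙 : Dec P → ℕ
𝟙 (yes _) = 1
𝟙 (no _)  = 0

𝟙-yes : (d : Dec P) → P → 𝟙 d ≡ 1
𝟙-yes (yes _) _  = refl
𝟙-yes (no ¬p) p  = ⊥-elim (¬p p)

𝟙-no : (d : Dec P) → ¬ P → 𝟙 d ≡ 0
𝟙-no (yes p) ¬p = ⊥-elim (¬p p)
𝟙-no (no _)  _  = refl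

𝟙-cong : (d : Dec P) (d′ : Dec P′) → (P → P′) → (P′ → P) → 𝟙 d ≡ 𝟙 d′
𝟙-cong d d′ to from with d | d′
... | yes _ | yes _  = refl
... | yes p | no ¬p′ = ⊥-elim (¬p′ (to p))
... | no ¬p | yes p′ = ⊥-elim (¬p (from p′))
... | no _  | no _   = refl

𝟙-× : (d : Dec P) (d′ : Dec P′) (d″ : Dec P″) → (P → P′ → P″) → (P″ → P × P′) →
      𝟙 d * 𝟙 d′ ≡ 𝟙 d″
𝟙-× (yes p) (yes p′) d″ to from = sym (𝟙-yes d″ (to p p′))
𝟙-× (yes p) (no ¬p′) d″ to from = sym (𝟙-no d″ (¬p′ ∘ proj₂ ∘ from))
𝟙-× (no ¬p) d′       d″ to from = sym (𝟙-no d″ (¬p ∘ proj₁ ∘ from))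

𝟙+𝟙¬≡1 : (d : Dec P) → 𝟙 d + 𝟙 (¬? d) ≡ 1
𝟙+𝟙¬≡1 (yes _) = refl
𝟙+𝟙¬≡1 (no _)  = refl

select : Dec P → ℕ → ℕ → ℕ
select (yes _) X Y = X
select (no _)  X Y = Y

select-cong : (d : Dec P) (d′ : Dec P′) (X Y : ℕ) → (P → P′) → (P′ → P) →
              select d X Y ≡ select d′ X Y
select-cong d d′ X Y to from with d | d′
... | yes _ | yes _  = refl
... | yes p | no ¬p′ = ⊥-elim (¬p′ (to p))
... | no ¬p | yes p′ = ⊥-elim (¬p (from p′))
... | no _  | no _   = refl

select≡𝟙 : (d : Dec P) (X Y : ℕ) → select d X Y ≡ 𝟙 d * X + 𝟙 (¬? d) * Y
select≡𝟙 (yes _) X Y = sym (trans (+-identityʳ (X + 0)) (+-identityʳ X))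
select≡𝟙 (no _)  X Y = sym (+-identityʳ Y)

≤-of-+ : ∀ {m n o} → m + n ≡ o → m ≤ o
≤-of-+ {m} {n} refl = m≤m+n m n

∑< : ℕ → (ℕ → ℕ) → ℕ
∑< zero    f = 0
∑< (suc n) f = ∑< n f + f n

syntax ∑< n (λ x → e) = ∑[ x < n ] e

∑-cong : ∀ n {f g : ℕ → ℕ} → (∀ x → x < n → f x ≡ g x) → ∑< n f ≡ ∑< n g
∑-cong zero    eq = refl
∑-cong (suc n) eq = cong₂ _+_ (∑-cong n (λ x x<n → eq x (m≤n⇒m≤1+n x<n))) (eq n ≤-refl)

∑-const : ∀ n k → ∑[ _ < n ] k ≡ n * k
∑-const zero    k = refl
∑-const (suc n) k rewrite ∑-const n k = +-comm (n * k) k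

∑-zeros : ∀ n {f : ℕ → ℕ} → (∀ x → x < n → f x ≡ 0) → ∑< n f ≡ 0
∑-zeros n eq = trans (∑-cong n eq) (trans (∑-const n 0) (*-zeroʳ n))

∑-mono-≤ : ∀ n {f g : ℕ → ℕ} → (∀ x → x < n → f x ≤ g x) → ∑< n f ≤ ∑< n g
∑-mono-≤ zero    le = z≤n
∑-mono-≤ (suc n) le = +-mono-≤ (∑-mono-≤ n (λ x x<n → le x (m≤n⇒m≤1+n x<n))) (le n ≤-refl)

f≤∑ : ∀ n (f : ℕ → ℕ) {k} → k < n → f k ≤ ∑< n f
f≤∑ (suc n) f {k} k<1+n with k ≟ n
... | yes refl = m≤n+m (f k) (∑< n f)
... | no k≢n   = ≤-trans (f≤∑ n f (≤∧≢⇒< (≤-pred k<1+n) k≢n)) (m≤m+n (∑< n f) (f n))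

∑-distrib-+ : ∀ n (f g : ℕ → ℕ) → ∑[ x < n ] (f x + g x) ≡ ∑< n f + ∑< n g
∑-distrib-+ zero    f g = refl
∑-distrib-+ (suc n) f g rewrite ∑-distrib-+ n f g = +-interchange (∑< n f) (∑< n g) (f n) (g n)

∑-*ˡ : ∀ n k (f : ℕ → ℕ) → ∑[ x < n ] (k * f x) ≡ k * ∑< n f
∑-*ˡ zero    k f = sym (*-zeroʳ k)
∑-*ˡ (suc n) k f rewrite ∑-*ˡ n k f = sym (*-distribˡ-+ k (∑< n f) (f n))

∑-*ʳ : ∀ n k (f : ℕ → ℕ) → ∑[ x < n ] (f x * k) ≡ ∑< n f * k
∑-*ʳ n k f = begin
  ∑[ x < n ] (f x * k) ≡⟨ ∑-cong n (λ x _ → *-comm (f x) k) ⟩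
  ∑[ x < n ] (k * f x) ≡⟨ ∑-*ˡ n k f ⟩
  k * ∑< n f           ≡⟨ *-comm k (∑< n f) ⟩
  ∑< n f * k           ∎
  where open ≡-Reasoning

∑-comm : ∀ n m (f : ℕ → ℕ → ℕ) → ∑[ x < n ] ∑[ y < m ] f x y ≡ ∑[ y < m ] ∑[ x < n ] f x y
∑-comm zero    m f = sym (∑-zeros m (λ _ _ → refl))
∑-comm (suc n) m f rewrite ∑-comm n m f = sym (∑-distrib-+ m (λ y → ∑[ x < n ] f x y) (f n))

∑-split : ∀ n m (f : ℕ → ℕ) → ∑< (n + m) f ≡ ∑< n f + ∑[ y < m ] f (n + y)
∑-split n zero    f rewrite +-identityʳ n = sym (+-identityʳ _)
∑-split n (suc m) f rewrite +-suc n m | ∑-split n m f = +-assoc (∑< n f) _ _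

∑-point : ∀ n {k} (g : ℕ → ℕ) → k < n → ∑[ y < n ] (𝟙 (y ≟ k) * g y) ≡ g k
∑-point (suc n) {k} g k<1+n with k ≟ n
... | yes refl
  rewrite ∑-zeros n {λ y → 𝟙 (y ≟ k) * g y} (λ y y<n → cong (_* g y) (𝟙-no (y ≟ k) (λ { refl → <-irrefl refl y<n })))
        | 𝟙-yes (k ≟ k) refl = +-identityʳ (g k)
... | no k≢n rewrite 𝟙-no (n ≟ k) (k≢n ∘ sym) | ∑-point n g (≤∧≢⇒< (≤-pred k<1+n) k≢n) = +-identityʳ (g k)

∑-periodic : ∀ m Q .{{_ : NonZero Q}} (g : ℕ → ℕ) → (∀ x → g x ≡ g (x % Q)) → ∑< (m * Q) g ≡ m * ∑< Q g
∑-periodic zero    Q g per = refl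
∑-periodic (suc m) Q g per = begin
  ∑< (Q + m * Q) g                            ≡⟨ cong (λ n → ∑< n g) (+-comm Q (m * Q)) ⟩
  ∑< (m * Q + Q) g                            ≡⟨ ∑-split (m * Q) Q g ⟩
  ∑< (m * Q) g + ∑[ y < Q ] g (m * Q + y)     ≡⟨ cong₂ _+_ (∑-periodic m Q g per) (∑-cong Q shift) ⟩
  m * ∑< Q g + ∑< Q g                         ≡⟨ +-comm (m * ∑< Q g) _ ⟩
  suc m * ∑< Q g                              ∎
  where
  open ≡-Reasoning
  shift : ∀ y → y < Q → g (m * Q + y) ≡ g y
  shift y y<Q = begin
    g (m * Q + y)      ≡⟨ per _ ⟩
    g ((m * Q + y) % Q) ≡⟨ cong g (%-congˡ (+-comm (m * Q) y)) ⟩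
    g ((y + m * Q) % Q) ≡⟨ cong g ([m+kn]%n≡m%n y m Q) ⟩
    g (y % Q)           ≡⟨ cong g (m<n⇒m%n≡m y<Q) ⟩
    g y                 ∎

∑≤n : ∀ n {f : ℕ → ℕ} → (∀ x → x < n → f x ≤ 1) → ∑< n f ≤ n
∑≤n n {f} f≤1 = subst (∑< n f ≤_) (trans (∑-const n 1) (*-identityʳ n)) (∑-mono-≤ n f≤1)

+≡1+n : ∀ {n s t} → s ≤ n → t ≤ 1 → s + t ≡ suc n → s ≡ n × t ≡ 1
+≡1+n {n} {s} {0}           s≤n _        eq = ⊥-elim (1+n≰n (subst (_≤ n) (trans (sym (+-identityʳ s)) eq) s≤n))
+≡1+n {n} {s} {1}           _   _        eq = +-cancelʳ-≡ 1 s n (trans eq (+-comm 1 n)) , refl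
+≡1+n     {t = suc (suc _)} _   (s≤s ())

∑≡n⇒all≡1 : ∀ n (f : ℕ → ℕ) → (∀ x → x < n → f x ≤ 1) → ∑< n f ≡ n → ∀ x → x < n → f x ≡ 1
∑≡n⇒all≡1 (suc n) f f≤1 ∑≡1+n x x<1+n
  with x ≟ n | +≡1+n (∑≤n n (λ y y<n → f≤1 y (m≤n⇒m≤1+n y<n))) (f≤1 n ≤-refl) ∑≡1+n
... | yes refl | _ , fn≡1 = fn≡1
... | no x≢n   | ∑≡n , _  =
  ∑≡n⇒all≡1 n f (λ y y<n → f≤1 y (m≤n⇒m≤1+n y<n)) ∑≡n x (≤∧≢⇒< (≤-pred x<1+n) x≢n)

∑𝟙≤1 : ∀ n {P : ℕ → Set ℓ} (P? : ∀ x → Dec (P x)) →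
       (∀ {x y} → x < n → y < n → P x → P y → x ≡ y) → ∑[ x < n ] 𝟙 (P? x) ≤ 1
∑𝟙≤1 zero    P? unique = z≤n
∑𝟙≤1 (suc n) P? unique with P? n
... | no _  = subst (_≤ 1) (sym (+-identityʳ _)) (∑𝟙≤1 n P? (λ x<n y<n → unique (m≤n⇒m≤1+n x<n) (m≤n⇒m≤1+n y<n)))
... | yes pn = subst (_≤ 1) (sym (cong (_+ 1) (∑-zeros n none))) ≤-refl
  where
  none : ∀ x → x < n → 𝟙 (P? x) ≡ 0
  none x x<n = 𝟙-no (P? x) (λ px → <-irrefl (unique (m≤n⇒m≤1+n x<n) ≤-refl px pn) x<n)

-- Each fibre has at most one point, and the fibre sizes add up to N.
injective⇒fibre≡1 : ∀ N (f : ℕ → ℕ) → (∀ x → x < N → f x < N) →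
                    (∀ {x y} → x < N → y < N → f x ≡ f y → x ≡ y) →
                    ∀ r → r < N → ∑[ x < N ] 𝟙 (f x ≟ r) ≡ 1
injective⇒fibre≡1 N f f<N injective = ∑≡n⇒all≡1 N fibre fibre≤1 total
  where
  fibre : ℕ → ℕ
  fibre r = ∑[ x < N ] 𝟙 (f x ≟ r)
  fibre≤1 : ∀ r → r < N → fibre r ≤ 1
  fibre≤1 r _ = ∑𝟙≤1 N (λ x → f x ≟ r) (λ x<N y<N fx≡r fy≡r → injective x<N y<N (trans fx≡r (sym fy≡r)))
  hit-once : ∀ x → x < N → ∑[ r < N ] 𝟙 (f x ≟ r) ≡ 1
  hit-once x x<N = begin
    ∑[ r < N ] 𝟙 (f x ≟ r)
      ≡⟨ ∑-cong N (λ r _ → trans (𝟙-cong (f x ≟ r) (r ≟ f x) sym sym) (sym (*-identityʳ _))) ⟩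
    ∑[ r < N ] (𝟙 (r ≟ f x) * 1)
      ≡⟨ ∑-point N (λ _ → 1) (f<N x x<N) ⟩
    1                            ∎
    where open ≡-Reasoning
  total : ∑< N fibre ≡ N
  total = begin
    ∑< N fibre                             ≡⟨ ∑-comm N N (λ r x → 𝟙 (f x ≟ r)) ⟩
    ∑[ x < N ] ∑[ r < N ] 𝟙 (f x ≟ r)      ≡⟨ ∑-cong N hit-once ⟩
    ∑[ x < N ] 1                           ≡⟨ ∑-const N 1 ⟩
    N * 1                                  ≡⟨ *-identityʳ N ⟩
    N                                      ∎
    where open ≡-Reasoning

-- Residues and the Chinese remainder theorem

divMod-unique : ∀ Q .{{_ : NonZero Q}} {z z′ y y′} → y < Q → y′ < Q →
                z * Q + y ≡ z′ * Q + y′ → z ≡ z′ × y ≡ y′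
divMod-unique Q {z} {z′} {y} {y′} y<Q y′<Q eq = z≡z′ , y≡y′
  where
  open ≡-Reasoning
  y≡y′ : y ≡ y′
  y≡y′ = begin
    y                ≡⟨ sym (m<n⇒m%n≡m y<Q) ⟩
    y % Q            ≡⟨ sym ([m+kn]%n≡m%n y z Q) ⟩
    (y + z * Q) % Q  ≡⟨ %-congˡ (trans (+-comm y (z * Q)) (trans eq (+-comm (z′ * Q) y′))) ⟩
    (y′ + z′ * Q) % Q ≡⟨ [m+kn]%n≡m%n y′ z′ Q ⟩
    y′ % Q           ≡⟨ m<n⇒m%n≡m y′<Q ⟩
    y′               ∎
  z≡z′ : z ≡ z′
  z≡z′ = *-cancelʳ-≡ z z′ Q (+-cancelʳ-≡ y (z * Q) (z′ * Q) (trans eq (cong (λ n → z′ * Q + n) (sym y≡y′))))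

∣∧<⇒≡0 : ∀ {n d} → n ∣ d → d < n → d ≡ 0
∣∧<⇒≡0 {d = zero}  _   _   = refl
∣∧<⇒≡0 {d = suc _} n∣d d<n = ⊥-elim (>⇒∤ d<n n∣d)

∣∸∧<⇒≡ : ∀ {N x y} → x ≤ y → y < N → N ∣ y ∸ x → x ≡ y
∣∸∧<⇒≡ {x = x} {y} x≤y y<N N∣y∸x =
  ≤-antisym x≤y (m∸n≡0⇒m≤n (∣∧<⇒≡0 N∣y∸x (≤-<-trans (m∸n≤m y x) y<N)))

%≡%⇒∣∸ : ∀ Q .{{_ : NonZero Q}} {x y} → x ≤ y → x % Q ≡ y % Q → Q ∣ y ∸ x
%≡%⇒∣∸ Q {x} {y} x≤y eq = divides (y / Q ∸ x / Q) (begin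
  y ∸ x                                     ≡⟨ cong₂ _∸_ (m≡m%n+[m/n]*n y Q) (m≡m%n+[m/n]*n x Q) ⟩
  (y % Q + y / Q * Q) ∸ (x % Q + x / Q * Q) ≡⟨ cong (λ r → (y % Q + y / Q * Q) ∸ (r + x / Q * Q)) eq ⟩
  (y % Q + y / Q * Q) ∸ (y % Q + x / Q * Q) ≡⟨ [m+n]∸[m+o]≡n∸o (y % Q) (y / Q * Q) (x / Q * Q) ⟩
  y / Q * Q ∸ x / Q * Q                     ≡⟨ sym (*-distribʳ-∸ Q (y / Q) (x / Q)) ⟩
  (y / Q ∸ x / Q) * Q                       ∎)
  where open ≡-Reasoning

injective-from-≤ : ∀ {A : Set ℓ} N (f : ℕ → A) →
                   (∀ {x y} → x ≤ y → y < N → f x ≡ f y → x ≡ y) →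
                   ∀ {x y} → x < N → y < N → f x ≡ f y → x ≡ y
injective-from-≤ N f inj-≤ {x} {y} x<N y<N eq with ≤-total x y
... | inj₁ x≤y = inj-≤ x≤y y<N eq
... | inj₂ y≤x = sym (inj-≤ y≤x x<N (sym eq))

*∣-coprime : ∀ {R Q n} → Coprime R Q → Q ∣ n → R ∣ n → R * Q ∣ n
*∣-coprime {R} {Q} R⊥Q (divides k refl) R∣kQ =
  subst₂ _∣_ (*-comm Q R) (*-comm Q k) (ℕ∣.*-monoʳ-∣ Q (coprime-divisor R⊥Q (subst (R ∣_) (*-comm k Q) R∣kQ)))

crt-injective : ∀ R Q .{{_ : NonZero Q}} .{{_ : NonZero R}} → Coprime R Q →
                ∀ {x y} → x < R * Q → y < R * Q → x % Q ≡ y % Q → x % R ≡ y % R → x ≡ y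
crt-injective R Q R⊥Q x<N y<N eqQ eqR =
  injective-from-≤ (R * Q) (λ x → x % Q , x % R) inj-≤ x<N y<N (cong₂ _,_ eqQ eqR)
  where
  inj-≤ : ∀ {x y} → x ≤ y → y < R * Q → (x % Q , x % R) ≡ (y % Q , y % R) → x ≡ y
  inj-≤ x≤y y<N eq =
    ∣∸∧<⇒≡ x≤y y<N (*∣-coprime R⊥Q (%≡%⇒∣∸ Q x≤y (cong proj₁ eq)) (%≡%⇒∣∸ R x≤y (cong proj₂ eq)))

coprime-%⁺ : ∀ b Q .{{_ : NonZero Q}} → Coprime b Q → Coprime (b % Q) Q
coprime-%⁺ b Q b⊥Q (d∣b%Q , d∣Q) =
  b⊥Q (subst (_ ∣_) (sym (m≡m%n+[m/n]*n b Q)) (ℕ∣.∣m∣n⇒∣m+n d∣b%Q (ℕ∣.∣n⇒∣m*n (b / Q) d∣Q)) , d∣Q)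

coprime-%⁻ : ∀ b Q .{{_ : NonZero Q}} → Coprime (b % Q) Q → Coprime b Q
coprime-%⁻ b Q b%Q⊥Q (d∣b , d∣Q) =
  b%Q⊥Q (ℕ∣.∣m+n∣m⇒∣n (subst (_ ∣_) (trans (m≡m%n+[m/n]*n b Q) (+-comm (b % Q) _)) d∣b)
                      (ℕ∣.∣n⇒∣m*n (b / Q) d∣Q) , d∣Q)

coprime-*⁻ : ∀ {b R Q} → Coprime b (R * Q) → Coprime b Q × Coprime b R
coprime-*⁻ {R = R} {Q} b⊥RQ = (λ (d∣b , d∣Q) → b⊥RQ (d∣b , ℕ∣.∣n⇒∣m*n R d∣Q))
                            , (λ (d∣b , d∣R) → b⊥RQ (d∣b , ℕ∣.∣m⇒∣m*n Q d∣R))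

coprime-*⁺ : ∀ {b R Q} → Coprime b Q → Coprime b R → Coprime b (R * Q)
coprime-*⁺ b⊥Q b⊥R (d∣b , d∣RQ) =
  b⊥Q (d∣b , coprime-divisor (λ (e∣d , e∣R) → b⊥R (ℕ∣.∣-trans e∣d d∣b , e∣R)) d∣RQ)

-- x ↦ (x % R) * Q + x % Q is a bijection of [0, RQ) (Chinese remainder theorem).
module _ (R Q : ℕ) .{{_ : NonZero Q}} .{{_ : NonZero R}} (R⊥Q : Coprime R Q) where

  private
    crt : ℕ → ℕ
    crt x = (x % R) * Q + x % Q

    <RQ : ∀ {z y} → z < R → y < Q → z * Q + y < R * Q
    <RQ {z} z<R y<Q = ≤-trans (+-monoʳ-< (z * Q) y<Q) (≤-trans (≤-reflexive (+-comm (z * Q) Q)) (*-monoˡ-≤ Q z<R))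

    crt-injective′ : ∀ {x y} → x < R * Q → y < R * Q → crt x ≡ crt y → x ≡ y
    crt-injective′ {x} {y} x<N y<N eq =
      let (eqR , eqQ) = divMod-unique Q (m%n<n x Q) (m%n<n y Q) eq in crt-injective R Q R⊥Q x<N y<N eqQ eqR

  ∑-crt : (g₁ g₂ : ℕ → ℕ) → (∀ x → g₁ x ≡ g₁ (x % Q)) → (∀ x → g₂ x ≡ g₂ (x % R)) →
          ∑[ x < R * Q ] (g₁ x * g₂ x) ≡ ∑< Q g₁ * ∑< R g₂
  ∑-crt g₁ g₂ per₁ per₂ = begin
      ∑[ x < N ] (g₁ x * g₂ x)                       ≡⟨ ∑-cong N (λ x _ → expand x) ⟩
      ∑[ x < N ] ∑[ z < R ] ∑[ y < Q ] F x z y       ≡⟨ ∑-comm N R _ ⟩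
      ∑[ z < R ] ∑[ x < N ] ∑[ y < Q ] F x z y       ≡⟨ ∑-cong R (λ z _ → ∑-comm N Q _) ⟩
      ∑[ z < R ] ∑[ y < Q ] ∑[ x < N ] F x z y       ≡⟨ ∑-cong R (λ z z<R → ∑-cong Q (λ y y<Q → collapse z<R y<Q)) ⟩
      ∑[ z < R ] ∑[ y < Q ] (g₁ y * g₂ z)            ≡⟨ ∑-cong R (λ z _ → ∑-*ʳ Q (g₂ z) g₁) ⟩
      ∑[ z < R ] (∑< Q g₁ * g₂ z)                    ≡⟨ ∑-*ˡ R (∑< Q g₁) g₂ ⟩
      ∑< Q g₁ * ∑< R g₂                              ∎
    where
    open ≡-Reasoning
    N = R * Q
    F : ℕ → ℕ → ℕ → ℕ
    F x z y = 𝟙 (z ≟ x % R) * (𝟙 (y ≟ x % Q) * (g₁ y * g₂ z))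
    expand : ∀ x → g₁ x * g₂ x ≡ ∑[ z < R ] ∑[ y < Q ] F x z y
    expand x = sym (begin
      ∑[ z < R ] ∑[ y < Q ] F x z y
        ≡⟨ ∑-cong R (λ z _ → ∑-*ˡ Q (𝟙 (z ≟ x % R)) _) ⟩
      ∑[ z < R ] (𝟙 (z ≟ x % R) * ∑[ y < Q ] (𝟙 (y ≟ x % Q) * (g₁ y * g₂ z)))
        ≡⟨ ∑-cong R (λ z _ → cong (𝟙 (z ≟ x % R) *_) (∑-point Q (λ y → g₁ y * g₂ z) (m%n<n x Q))) ⟩
      ∑[ z < R ] (𝟙 (z ≟ x % R) * (g₁ (x % Q) * g₂ z))
        ≡⟨ ∑-point R (λ z → g₁ (x % Q) * g₂ z) (m%n<n x R) ⟩
      g₁ (x % Q) * g₂ (x % R)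
        ≡⟨ sym (cong₂ _*_ (per₁ x) (per₂ x)) ⟩
      g₁ x * g₂ x ∎)
    collapse : ∀ {z y} → z < R → y < Q → ∑[ x < N ] F x z y ≡ g₁ y * g₂ z
    collapse {z} {y} z<R y<Q = begin
      ∑[ x < N ] F x z y
        ≡⟨ ∑-cong N (λ x _ → sym (*-assoc (𝟙 (z ≟ x % R)) _ _)) ⟩
      ∑[ x < N ] (𝟙 (z ≟ x % R) * 𝟙 (y ≟ x % Q) * (g₁ y * g₂ z))
        ≡⟨ ∑-cong N (λ x _ → cong (_* (g₁ y * g₂ z)) (crt-fibre x)) ⟩
      ∑[ x < N ] (𝟙 (crt x ≟ z * Q + y) * (g₁ y * g₂ z))
        ≡⟨ ∑-*ʳ N (g₁ y * g₂ z) _ ⟩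
      ∑[ x < N ] 𝟙 (crt x ≟ z * Q + y) * (g₁ y * g₂ z)
        ≡⟨ cong (_* (g₁ y * g₂ z))
                (injective⇒fibre≡1 N crt (λ x _ → <RQ (m%n<n x R) (m%n<n x Q)) crt-injective′ _ (<RQ z<R y<Q)) ⟩
      1 * (g₁ y * g₂ z)
        ≡⟨ *-identityˡ _ ⟩
      g₁ y * g₂ z ∎
      where
      crt-fibre : ∀ x → 𝟙 (z ≟ x % R) * 𝟙 (y ≟ x % Q) ≡ 𝟙 (crt x ≟ z * Q + y)
      crt-fibre x = 𝟙-× (z ≟ x % R) (y ≟ x % Q) (crt x ≟ z * Q + y)
        (λ { refl refl → refl })
        (λ eq → let (eqR , eqQ) = divMod-unique Q (m%n<n x Q) y<Q eq in sym eqR , sym eqQ)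

-- Divisibility of an integer n by M ∈ ℕ, in the unsigned form M ∣ ∣ n ∣ used by Defs.
module ℤ∣ {M : ℕ} where

  private
    signed : ∀ {n} → M ∣ ∣ n ∣ → + M ℤ∣ˢ.∣ n
    signed {n} = ℤ∣ˢ.∣ᵤ⇒∣ {+ M} {n}

    unsigned : ∀ {n} → + M ℤ∣ˢ.∣ n → M ∣ ∣ n ∣
    unsigned {n} = ℤ∣ˢ.∣⇒∣ᵤ {+ M} {n}

  ∣m∣n⇒∣m+n : ∀ {m n} → M ∣ ∣ m ∣ → M ∣ ∣ n ∣ → M ∣ ∣ m ℤ.+ n ∣
  ∣m∣n⇒∣m+n {m} {n} M∣m M∣n = unsigned {m ℤ.+ n} (ℤ∣ˢ.∣m∣n⇒∣m+n (signed {m} M∣m) (signed {n} M∣n))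

  ∣m+n∣m⇒∣n : ∀ {m n} → M ∣ ∣ m ℤ.+ n ∣ → M ∣ ∣ m ∣ → M ∣ ∣ n ∣
  ∣m+n∣m⇒∣n {m} {n} M∣m+n M∣m = unsigned {n} (ℤ∣ˢ.∣m+n∣m⇒∣n (signed {m ℤ.+ n} M∣m+n) (signed {m} M∣m))

  ∣m+n∣n⇒∣m : ∀ {m n} → M ∣ ∣ m ℤ.+ n ∣ → M ∣ ∣ n ∣ → M ∣ ∣ m ∣
  ∣m+n∣n⇒∣m {m} {n} M∣m+n M∣n = unsigned {m} (ℤ∣ˢ.∣m+n∣n⇒∣m (signed {m ℤ.+ n} M∣m+n) (signed {n} M∣n))

  ∣m⇒∣m*n : ∀ {m} n → M ∣ ∣ m ∣ → M ∣ ∣ m ℤ.* n ∣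
  ∣m⇒∣m*n {m} n M∣m = subst (M ∣_) (sym (ℤ.abs-* m n)) (ℕ∣.∣m⇒∣m*n ∣ n ∣ M∣m)

  ∣n⇒∣m*n : ∀ m {n} → M ∣ ∣ n ∣ → M ∣ ∣ m ℤ.* n ∣
  ∣n⇒∣m*n m {n} M∣n = subst (M ∣_) (sym (ℤ.abs-* m n)) (ℕ∣.∣n⇒∣m*n ∣ m ∣ M∣n)

  ∣n*M : ∀ n → M ∣ ∣ n ℤ.* + M ∣
  ∣n*M n = ∣n⇒∣m*n n {+ M} ℕ∣.∣-refl

  ∣⇒%ℕ≡0 : .{{_ : NonZero M}} → ∀ n → M ∣ ∣ n ∣ → n ℤ.%ℕ M ≡ 0
  ∣⇒%ℕ≡0 n M∣n = ∣∧<⇒≡0 M∣r (n%ℕd<d n M)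
    where
    M∣r : M ∣ ∣ + (n ℤ.%ℕ M) ∣
    M∣r = ∣m+n∣n⇒∣m {+ (n ℤ.%ℕ M)} {n ℤ./ℕ M ℤ.* + M}
            (subst (λ m → M ∣ ∣ m ∣) (a≡a%ℕn+[a/ℕn]*n n M) M∣n) (∣n*M (n ℤ./ℕ M))

  %ℕ≡0⇒∣ : .{{_ : NonZero M}} → ∀ n → n ℤ.%ℕ M ≡ 0 → M ∣ ∣ n ∣
  %ℕ≡0⇒∣ n eq = subst (λ m → M ∣ ∣ m ∣) (sym (a≡a%ℕn+[a/ℕn]*n n M))
    (∣m∣n⇒∣m+n {+ (n ℤ.%ℕ M)} {n ℤ./ℕ M ℤ.* + M} (subst (M ∣_) (sym eq) (M ℕ∣.∣0)) (∣n*M (n ℤ./ℕ M)))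

-- Counting solutions modulo Q

𝟙[_∣_] : ℕ → ℤ → ℕ
𝟙[ Q ∣ c ] = 𝟙 (Q ∣? ∣ c ∣)

∑ᵘ : ℕ → (ℕ → ℕ) → ℕ
∑ᵘ Q f = ∑[ b < Q ] (𝟙 (coprime? b Q) * f b)

∑ᵘ-cong : ∀ Q {f g : ℕ → ℕ} → (∀ b → f b ≡ g b) → ∑ᵘ Q f ≡ ∑ᵘ Q g
∑ᵘ-cong Q eq = ∑-cong Q (λ b _ → cong (𝟙 (coprime? b Q) *_) (eq b))

conv : ℕ → ℤ → (ℤ → ℕ) → ℤ → ℕ
conv Q a h c = ∑ᵘ Q (λ b → h (c ℤ.+ a ℤ.* + b))

conv-cong : ∀ Q a {h h′ : ℤ → ℕ} → (∀ c → h c ≡ h′ c) → ∀ c → conv Q a h c ≡ conv Q a h′ c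
conv-cong Q a eq c = ∑ᵘ-cong Q (λ b → eq _)

conv-comm : ∀ Q a a′ (h : ℤ → ℕ) c → conv Q a (conv Q a′ h) c ≡ conv Q a′ (conv Q a h) c
conv-comm Q a a′ h c = begin
    ∑[ x < Q ] (u x * ∑[ y < Q ] (u y * h (c ℤ.+ a ℤ.* + x ℤ.+ a′ ℤ.* + y)))
  ≡⟨ ∑-cong Q (λ x _ → sym (∑-*ˡ Q (u x) _)) ⟩
    ∑[ x < Q ] ∑[ y < Q ] (u x * (u y * h (c ℤ.+ a ℤ.* + x ℤ.+ a′ ℤ.* + y)))
  ≡⟨ ∑-comm Q Q _ ⟩
    ∑[ y < Q ] ∑[ x < Q ] (u x * (u y * h (c ℤ.+ a ℤ.* + x ℤ.+ a′ ℤ.* + y)))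
  ≡⟨ ∑-cong Q (λ y _ → ∑-cong Q (λ x _ → trans (*-left-comm (u x) (u y) _)
                                           (cong (λ n → u y * (u x * h n)) (shuffle c (a ℤ.* + x) (a′ ℤ.* + y))))) ⟩
    ∑[ y < Q ] ∑[ x < Q ] (u y * (u x * h (c ℤ.+ a′ ℤ.* + y ℤ.+ a ℤ.* + x)))
  ≡⟨ ∑-cong Q (λ y _ → ∑-*ˡ Q (u y) _) ⟩
    ∑[ y < Q ] (u y * ∑[ x < Q ] (u x * h (c ℤ.+ a′ ℤ.* + y ℤ.+ a ℤ.* + x))) ∎
  where
  open ≡-Reasoning
  u : ℕ → ℕ
  u b = 𝟙 (coprime? b Q)
  shuffle : ∀ c x y → c ℤ.+ x ℤ.+ y ≡ c ℤ.+ y ℤ.+ x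
  shuffle = ℤ-Solver.solve-∀

i₀ i₁ i₂ i₃ : Fin 4
i₀ = Fin.zero
i₁ = Fin.suc Fin.zero
i₂ = Fin.suc (Fin.suc Fin.zero)
i₃ = Fin.suc (Fin.suc (Fin.suc Fin.zero))

-- solCountAt a Q c = #{ b ∈ ((ℤ/Qℤ)*)⁴ : Q ∣ c + a·b }
solCountAt : Vec4 → ℕ → ℤ → ℕ
solCountAt a Q = conv Q (a i₀) (conv Q (a i₁) (conv Q (a i₂) (conv Q (a i₃) 𝟙[ Q ∣_])))

∑∈ : List ℕ → (ℕ → ℕ) → ℕ
∑∈ []       f = 0
∑∈ (x ∷ xs) f = f x + ∑∈ xs f

∑∈-++ : ∀ xs ys f → ∑∈ (xs ++ ys) f ≡ ∑∈ xs f + ∑∈ ys f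
∑∈-++ []       ys f = refl
∑∈-++ (x ∷ xs) ys f rewrite ∑∈-++ xs ys f = sym (+-assoc (f x) _ _)

∑∈-upTo : ∀ n f → ∑∈ (upTo n) f ≡ ∑< n f
∑∈-upTo zero    f = refl
∑∈-upTo (suc n) f = begin
  ∑∈ (upTo (suc n)) f         ≡⟨ cong (λ xs → ∑∈ xs f) (sym (upTo-∷ʳ n)) ⟩
  ∑∈ (upTo n ++ [ n ]) f      ≡⟨ ∑∈-++ (upTo n) [ n ] f ⟩
  ∑∈ (upTo n) f + (f n + 0)   ≡⟨ cong₂ _+_ (∑∈-upTo n f) (+-identityʳ (f n)) ⟩
  ∑< n f + f n                ∎
  where open ≡-Reasoning

∑∈-filter : ∀ {P : ℕ → Set} (P? : ∀ x → Dec (P x)) xs f → ∑∈ (filter P? xs) f ≡ ∑∈ xs (λ x → 𝟙 (P? x) * f x)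
∑∈-filter P? []       f = refl
∑∈-filter P? (x ∷ xs) f with P? x
... | yes _ = cong₂ _+_ (sym (+-identityʳ (f x))) (∑∈-filter P? xs f)
... | no _  = ∑∈-filter P? xs f

∑∈-units : ∀ Q f → ∑∈ (units Q) f ≡ ∑ᵘ Q f
∑∈-units Q f = trans (∑∈-filter (λ b → coprime? b Q) (upTo Q) f) (∑∈-upTo Q _)

length≡∑∈1 : (xs : List ℕ) → length xs ≡ ∑∈ xs (λ _ → 1)
length≡∑∈1 []       = refl
length≡∑∈1 (x ∷ xs) = cong suc (length≡∑∈1 xs)

φ≡∑ᵘ1 : ∀ Q → φ Q ≡ ∑ᵘ Q (λ _ → 1)
φ≡∑ᵘ1 Q = trans (length≡∑∈1 (units Q)) (∑∈-units Q (λ _ → 1))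

module _ {A : Set} {P : A → Set} (P? : ∀ x → Dec (P x)) where

  length-filter-concatMap : ∀ (g : ℕ → List A) xs →
    length (filter P? (concatMap g xs)) ≡ ∑∈ xs (λ x → length (filter P? (g x)))
  length-filter-concatMap g []       = refl
  length-filter-concatMap g (x ∷ xs) = begin
    length (filter P? (g x ++ concatMap g xs))
      ≡⟨ cong length (filter-++ P? (g x) (concatMap g xs)) ⟩
    length (filter P? (g x) ++ filter P? (concatMap g xs))
      ≡⟨ length-++ (filter P? (g x)) ⟩
    length (filter P? (g x)) + length (filter P? (concatMap g xs))
      ≡⟨ cong (λ n → length (filter P? (g x)) + n) (length-filter-concatMap g xs) ⟩
    length (filter P? (g x)) + ∑∈ xs (λ x → length (filter P? (g x))) ∎
    where open ≡-Reasoning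

  length-filter-map : ∀ (g : ℕ → A) xs → length (filter P? (map g xs)) ≡ ∑∈ xs (λ x → 𝟙 (P? (g x)))
  length-filter-map g []       = refl
  length-filter-map g (x ∷ xs) with P? (g x)
  ... | yes _ = cong suc (length-filter-map g xs)
  ... | no _  = length-filter-map g xs

solCount≡solCountAt : ∀ a Q → solCount a Q ≡ solCountAt a Q (+ 0)
solCount≡solCountAt a Q =
  trans (length-filter-concatMap P? _ (units Q)) (trans (∑∈-units Q _) (∑ᵘ-cong Q λ b₁ →
  trans (length-filter-concatMap P? _ (units Q)) (trans (∑∈-units Q _) (∑ᵘ-cong Q λ b₂ →
  trans (length-filter-concatMap P? _ (units Q)) (trans (∑∈-units Q _) (∑ᵘ-cong Q λ b₃ →
  trans (length-filter-map P? _ (units Q)) (trans (∑∈-units Q _) (∑ᵘ-cong Q λ b₄ →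
  cong 𝟙[ Q ∣_] (sym (reassoc (a i₀ ℤ.* + b₁) (a i₁ ℤ.* + b₂) (a i₂ ℤ.* + b₃) (a i₃ ℤ.* + b₄)))))))))))
  where
  P? : (b : Vec4) → Dec (Q ∣ ∣ dot a b ∣)
  P? b = Q ∣? ∣ dot a b ∣
  reassoc : ∀ w x y z → + 0 ℤ.+ w ℤ.+ x ℤ.+ y ℤ.+ z ≡ w ℤ.+ (x ℤ.+ (y ℤ.+ z))
  reassoc = ℤ-Solver.solve-∀

-- Multiplicativity in Q

Periodic : ℕ → (ℤ → ℕ) → Set
Periodic M h = ∀ c k → h (c ℤ.+ k ℤ.* + M) ≡ h c

𝟙∣-periodic : ∀ Q → Periodic Q 𝟙[ Q ∣_]
𝟙∣-periodic Q c k = 𝟙-cong (Q ∣? _) (Q ∣? _)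
  (λ Q∣ → ℤ∣.∣m+n∣n⇒∣m {Q} {c} {k ℤ.* + Q} Q∣ (ℤ∣.∣n*M k))
  (λ Q∣ → ℤ∣.∣m∣n⇒∣m+n {Q} {c} {k ℤ.* + Q} Q∣ (ℤ∣.∣n*M k))

conv-periodic : ∀ Q a {h} → Periodic Q h → Periodic Q (conv Q a h)
conv-periodic Q a {h} per c k = ∑ᵘ-cong Q λ b → trans (cong h (shuffle c k (+ Q) a (+ b))) (per _ k)
  where
  shuffle : ∀ c k q a b → c ℤ.+ k ℤ.* q ℤ.+ a ℤ.* b ≡ c ℤ.+ a ℤ.* b ℤ.+ k ℤ.* q
  shuffle = ℤ-Solver.solve-∀

periodic-% : ∀ M .{{_ : NonZero M}} {h} → Periodic M h → ∀ c a b → h (c ℤ.+ a ℤ.* + b) ≡ h (c ℤ.+ a ℤ.* + (b % M))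
periodic-% M {h} per c a b =
  trans (cong h (trans (cong (λ n → c ℤ.+ a ℤ.* n) b≡) (expand c a _ _ (+ M)))) (per _ (a ℤ.* + (b / M)))
  where
  b≡ : + b ≡ + (b % M) ℤ.+ + (b / M) ℤ.* + M
  b≡ = trans (cong +_ (m≡m%n+[m/n]*n b M))
             (trans (ℤ.pos-+ (b % M) _) (cong (λ n → + (b % M) ℤ.+ n) (ℤ.pos-* (b / M) M)))
  expand : ∀ c a r s m → c ℤ.+ a ℤ.* (r ℤ.+ s ℤ.* m) ≡ c ℤ.+ a ℤ.* r ℤ.+ a ℤ.* s ℤ.* m
  expand = ℤ-Solver.solve-∀

𝟙∣-* : ∀ {R Q} → Coprime R Q → ∀ c → 𝟙[ R * Q ∣ c ] ≡ 𝟙[ Q ∣ c ] * 𝟙[ R ∣ c ]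
𝟙∣-* {R} {Q} R⊥Q c = sym (𝟙-× (Q ∣? _) (R ∣? _) (R * Q ∣? _)
  (*∣-coprime R⊥Q)
  (λ RQ∣c → ℕ∣.∣-trans (ℕ∣.n∣m*n R) RQ∣c , ℕ∣.∣-trans (ℕ∣.m∣m*n Q) RQ∣c))

conv-* : ∀ R Q .{{_ : NonZero Q}} .{{_ : NonZero R}} → Coprime R Q → ∀ a {hQ hR hRQ : ℤ → ℕ} →
         Periodic Q hQ → Periodic R hR → (∀ c → hRQ c ≡ hQ c * hR c) →
         ∀ c → conv (R * Q) a hRQ c ≡ conv Q a hQ c * conv R a hR c
conv-* R Q R⊥Q a {hQ} {hR} {hRQ} perQ perR hRQ≡ c =
  trans (∑-cong (R * Q) (λ b _ → factor b)) (∑-crt R Q R⊥Q g₁ g₂ per₁ per₂)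
  where
  g₁ g₂ : ℕ → ℕ
  g₁ b = 𝟙 (coprime? b Q) * hQ (c ℤ.+ a ℤ.* + b)
  g₂ b = 𝟙 (coprime? b R) * hR (c ℤ.+ a ℤ.* + b)
  factor : ∀ b → 𝟙 (coprime? b (R * Q)) * hRQ (c ℤ.+ a ℤ.* + b) ≡ g₁ b * g₂ b
  factor b = trans
    (cong₂ _*_ (sym (𝟙-× (coprime? b Q) (coprime? b R) (coprime? b (R * Q)) coprime-*⁺ coprime-*⁻)) (hRQ≡ _))
    (*-interchange (𝟙 (coprime? b Q)) _ _ _)
  per₁ : ∀ x → g₁ x ≡ g₁ (x % Q)
  per₁ x = cong₂ _*_ (𝟙-cong (coprime? x Q) (coprime? (x % Q) Q) (coprime-%⁺ x Q) (coprime-%⁻ x Q)) (periodic-% Q perQ c a x)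
  per₂ : ∀ x → g₂ x ≡ g₂ (x % R)
  per₂ x = cong₂ _*_ (𝟙-cong (coprime? x R) (coprime? (x % R) R) (coprime-%⁺ x R) (coprime-%⁻ x R)) (periodic-% R perR c a x)

solCountAt-* : ∀ a R Q .{{_ : NonZero Q}} .{{_ : NonZero R}} → Coprime R Q →
               ∀ c → solCountAt a (R * Q) c ≡ solCountAt a Q c * solCountAt a R c
solCountAt-* a R Q R⊥Q =
  conv-* R Q R⊥Q (a i₀) (per₁ Q) (per₁ R) (conv-* R Q R⊥Q (a i₁) (per₂ Q) (per₂ R)
    (conv-* R Q R⊥Q (a i₂) (per₃ Q) (per₃ R) (conv-* R Q R⊥Q (a i₃) (𝟙∣-periodic Q) (𝟙∣-periodic R) (𝟙∣-* R⊥Q))))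
  where
  per₃ : ∀ M → Periodic M (conv M (a i₃) 𝟙[ M ∣_])
  per₃ M = conv-periodic M (a i₃) (𝟙∣-periodic M)
  per₂ : ∀ M → Periodic M (conv M (a i₂) (conv M (a i₃) 𝟙[ M ∣_]))
  per₂ M = conv-periodic M (a i₂) (per₃ M)
  per₁ : ∀ M → Periodic M (conv M (a i₁) (conv M (a i₂) (conv M (a i₃) 𝟙[ M ∣_])))
  per₁ M = conv-periodic M (a i₁) (per₂ M)

solCount-* : ∀ a R Q .{{_ : NonZero Q}} .{{_ : NonZero R}} → Coprime R Q →
             solCount a (R * Q) ≡ solCount a Q * solCount a R
solCount-* a R Q R⊥Q = begin
  solCount a (R * Q)                          ≡⟨ solCount≡solCountAt a (R * Q) ⟩
  solCountAt a (R * Q) (+ 0)                  ≡⟨ solCountAt-* a R Q R⊥Q (+ 0) ⟩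
  solCountAt a Q (+ 0) * solCountAt a R (+ 0) ≡⟨ sym (cong₂ _*_ (solCount≡solCountAt a Q) (solCount≡solCountAt a R)) ⟩
  solCount a Q * solCount a R                 ∎
  where open ≡-Reasoning

φ-* : ∀ R Q .{{_ : NonZero Q}} .{{_ : NonZero R}} → Coprime R Q → φ (R * Q) ≡ φ Q * φ R
φ-* R Q R⊥Q = begin
  φ (R * Q)
    ≡⟨ φ≡∑ᵘ1 (R * Q) ⟩
  conv (R * Q) (+ 0) (λ _ → 1) (+ 0)
    ≡⟨ conv-* R Q R⊥Q (+ 0) {λ _ → 1} {λ _ → 1} (λ _ _ → refl) (λ _ _ → refl) (λ _ → refl) (+ 0) ⟩
  conv Q (+ 0) (λ _ → 1) (+ 0) * conv R (+ 0) (λ _ → 1) (+ 0)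
    ≡⟨ sym (cong₂ _*_ (φ≡∑ᵘ1 Q) (φ≡∑ᵘ1 R)) ⟩
  φ Q * φ R ∎
  where open ≡-Reasoning

∑ᵘ-pos : ∀ Q {f : ℕ → ℕ} {b} → b < Q → Coprime b Q → 1 ≤ f b → 1 ≤ ∑ᵘ Q f
∑ᵘ-pos Q {f} {b} b<Q b⊥Q 1≤fb = ≤-trans (subst (1 ≤_) (sym unit-term) 1≤fb) (f≤∑ Q _ b<Q)
  where
  unit-term : 𝟙 (coprime? b Q) * f b ≡ f b
  unit-term = trans (cong (_* f b) (𝟙-yes (coprime? b Q) b⊥Q)) (*-identityˡ (f b))

linear-congruence : ∀ M .{{_ : NonZero M}} (a c : ℤ) → Coprime M ∣ a ∣ →
                    ∑[ b < M ] 𝟙[ M ∣ c ℤ.+ a ℤ.* + b ] ≡ 1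
linear-congruence M a c M⊥a = begin
  ∑[ b < M ] 𝟙[ M ∣ lin b ]
    ≡⟨ ∑-cong M (λ b _ → 𝟙-cong (M ∣? _) (res b ≟ 0) (ℤ∣.∣⇒%ℕ≡0 (lin b)) (ℤ∣.%ℕ≡0⇒∣ (lin b))) ⟩
  ∑[ b < M ] 𝟙 (res b ≟ 0)
    ≡⟨ injective⇒fibre≡1 M res (λ b _ → n%ℕd<d (lin b) M) (injective-from-≤ M res inj-≤) 0 (ℕ.>-nonZero⁻¹ M) ⟩
  1 ∎
  where
  open ≡-Reasoning
  lin : ℕ → ℤ
  lin b = c ℤ.+ a ℤ.* + b
  res : ℕ → ℕ
  res b = lin b ℤ.%ℕ M
  diff : ∀ c a x y → (c ℤ.+ a ℤ.* x) ℤ.- (c ℤ.+ a ℤ.* y) ≡ a ℤ.* (x ℤ.- y)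
  diff = ℤ-Solver.solve-∀
  quot : ∀ r q q′ m → (r ℤ.+ q′ ℤ.* m) ℤ.- (r ℤ.+ q ℤ.* m) ≡ (q′ ℤ.- q) ℤ.* m
  quot = ℤ-Solver.solve-∀
  inj-≤ : ∀ {x y} → x ≤ y → y < M → res x ≡ res y → x ≡ y
  inj-≤ {x} {y} x≤y y<M eq = ∣∸∧<⇒≡ x≤y y<M (coprime-divisor M⊥a (subst (M ∣_) (ℤ.abs-* a (+ (y ∸ x))) M∣a[y-x]))
    where
    lin-y-x : lin y ℤ.- lin x ≡ (lin y ℤ./ℕ M ℤ.- lin x ℤ./ℕ M) ℤ.* + M
    lin-y-x = begin
      lin y ℤ.- lin x
        ≡⟨ cong₂ ℤ._-_ (a≡a%ℕn+[a/ℕn]*n (lin y) M)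
                       (trans (a≡a%ℕn+[a/ℕn]*n (lin x) M) (cong (λ r → + r ℤ.+ lin x ℤ./ℕ M ℤ.* + M) eq)) ⟩
      (+ res y ℤ.+ lin y ℤ./ℕ M ℤ.* + M) ℤ.- (+ res y ℤ.+ lin x ℤ./ℕ M ℤ.* + M)
        ≡⟨ quot (+ res y) (lin x ℤ./ℕ M) (lin y ℤ./ℕ M) (+ M) ⟩
      (lin y ℤ./ℕ M ℤ.- lin x ℤ./ℕ M) ℤ.* + M ∎
    lin-y-x′ : lin y ℤ.- lin x ≡ a ℤ.* + (y ∸ x)
    lin-y-x′ = trans (diff c a (+ y) (+ x)) (cong (a ℤ.*_) (trans (ℤ.m-n≡m⊖n y x) (ℤ.⊖-≥ x≤y)))
    M∣a[y-x] : M ∣ ∣ a ℤ.* + (y ∸ x) ∣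
    M∣a[y-x] = subst (λ n → M ∣ ∣ n ∣) (trans (sym lin-y-x) lin-y-x′) (ℤ∣.∣n*M (lin y ℤ./ℕ M ℤ.- lin x ℤ./ℕ M))

-- Prime powers

count-nondivisible : ∀ k → ∑[ b < suc k ] 𝟙 (¬? (suc k ∣? b)) ≡ k
count-nondivisible k = begin
  ∑[ b < 1 + k ] 𝟙 (¬? (suc k ∣? b))                                 ≡⟨ ∑-split 1 k _ ⟩
  0 + 𝟙 (¬? (suc k ∣? 0)) + ∑[ y < k ] 𝟙 (¬? (suc k ∣? (1 + y)))
    ≡⟨ cong₂ _+_ (𝟙-no (¬? (suc k ∣? 0)) (λ ∤0 → ∤0 (suc k ℕ∣.∣0)))
                 (∑-cong k (λ y y<k → 𝟙-yes (¬? (suc k ∣? (1 + y))) (ℕ∣.>⇒∤ (s≤s y<k)))) ⟩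
  ∑[ _ < k ] 1                                                       ≡⟨ ∑-const k 1 ⟩
  k * 1                                                              ≡⟨ *-identityʳ k ⟩
  k                                                                  ∎
  where open ≡-Reasoning

∸1≡1+∸2 : ∀ {n} → 1 < n → n ∸ 1 ≡ suc (n ∸ 2)
∸1≡1+∸2 {suc (suc _)} _         = refl
∸1≡1+∸2 {suc zero}    (s≤s ())

module PrimePower (p : ℕ) (p-prime : Prime p) where

  instance
    p≢0 : NonZero p
    p≢0 = prime⇒nonZero p-prime

    p^≢0 : ∀ {e} → NonZero (p ^ e)
    p^≢0 {e} = m^n≢0 p e

  1<p : 1 < p
  1<p = ℕ.nonTrivial⇒n>1 p {{prime⇒nonTrivial p-prime}}

  p∤1 : ¬ p ∣ 1
  p∤1 p∣1 = <-irrefl (sym (ℕ∣.∣1⇒≡1 p∣1)) 1<p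

  ∣*⇒∣⊎∣ : ∀ x y → p ∣ ∣ x ℤ.* y ∣ → (p ∣ ∣ x ∣) ⊎ (p ∣ ∣ y ∣)
  ∣*⇒∣⊎∣ x y p∣xy = euclidsLemma ∣ x ∣ ∣ y ∣ p-prime (subst (p ∣_) (ℤ.abs-* x y) p∣xy)

  ∤⇒coprime : ∀ {x} → ¬ p ∣ x → Coprime x p
  ∤⇒coprime p∤x (d∣x , d∣p) with prime⇒irreducible p-prime d∣p
  ... | inj₁ d≡1 = d≡1
  ... | inj₂ refl = ⊥-elim (p∤x d∣x)

  coprime-^ : ∀ {x} k → Coprime x p → Coprime x (p ^ k)
  coprime-^ zero    _    (_ , d∣1) = ℕ∣.∣1⇒≡1 d∣1
  coprime-^ (suc k) x⊥p = coprime-*⁺ (coprime-^ k x⊥p) x⊥p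

  coprime-p^⁻ : ∀ {x} e → Coprime x (p ^ suc e) → ¬ p ∣ x
  coprime-p^⁻ e x⊥Q p∣x = p∤1 (subst (p ∣_) (x⊥Q (p∣x , ℕ∣.m∣m*n (p ^ e))) ℕ∣.∣-refl)

  coprime-p^⁺ : ∀ {x} e → ¬ p ∣ x → Coprime x (p ^ suc e)
  coprime-p^⁺ e p∤x = coprime-^ (suc e) (∤⇒coprime p∤x)

  𝟙∤ : ℕ → ℕ
  𝟙∤ b = 𝟙 (¬? (p ∣? b))

  𝟙-coprime-p^ : ∀ e b → 𝟙 (coprime? b (p ^ suc e)) ≡ 𝟙∤ b
  𝟙-coprime-p^ e b = 𝟙-cong (coprime? b _) (¬? (p ∣? b)) (coprime-p^⁻ e) (coprime-p^⁺ e)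

  𝟙∤-periodic : ∀ b → 𝟙∤ b ≡ 𝟙∤ (b % p)
  𝟙∤-periodic b = 𝟙-cong (¬? (p ∣? b)) (¬? (p ∣? (b % p)))
    (λ p∤b p∣b%p → p∤b (ℕ∣.m%n≡0⇒n∣m b p (∣∧<⇒≡0 p∣b%p (m%n<n b p))))
    (λ p∤b%p p∣b → p∤b%p (subst (p ∣_) (sym (ℕ∣.n∣m⇒m%n≡0 b p p∣b)) (p ℕ∣.∣0)))

  ∑𝟙∤ : ∑< p 𝟙∤ ≡ p ∸ 1
  ∑𝟙∤ = subst (λ n → ∑[ b < n ] 𝟙 (¬? (n ∣? b)) ≡ p ∸ 1) p≡1+[p∸1] (count-nondivisible (p ∸ 1))
    where
    p≡1+[p∸1] : suc (p ∸ 1) ≡ p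
    p≡1+[p∸1] = trans (+-comm 1 (p ∸ 1)) (m∸n+n≡m (<⇒≤ 1<p))

  -- For a p-periodic integrand only the unit residues mod p matter.
  conv-p^ : ∀ e a {h} → Periodic p h → ∀ c →
            conv (p ^ suc e) a h c ≡ p ^ e * ∑[ b < p ] (𝟙∤ b * h (c ℤ.+ a ℤ.* + b))
  conv-p^ e a {h} per c = begin
    conv (p ^ suc e) a h c                       ≡⟨ ∑-cong (p ^ suc e) (λ b _ → cong (_* h _) (𝟙-coprime-p^ e b)) ⟩
    ∑< (p * p ^ e) g                             ≡⟨ cong (λ n → ∑< n g) (*-comm p (p ^ e)) ⟩
    ∑< (p ^ e * p) g
      ≡⟨ ∑-periodic (p ^ e) p g (λ b → cong₂ _*_ (𝟙∤-periodic b) (periodic-% p per c a b)) ⟩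
    p ^ e * ∑< p g                               ∎
    where
    open ≡-Reasoning
    g : ℕ → ℕ
    g b = 𝟙∤ b * h (c ℤ.+ a ℤ.* + b)

  φ-p^ : ∀ e → φ (p ^ suc e) ≡ p ^ e * (p ∸ 1)
  φ-p^ e = begin
    φ (p ^ suc e)                            ≡⟨ φ≡∑ᵘ1 (p ^ suc e) ⟩
    conv (p ^ suc e) (+ 0) (λ _ → 1) (+ 0)   ≡⟨ conv-p^ e (+ 0) {λ _ → 1} (λ _ _ → refl) (+ 0) ⟩
    p ^ e * ∑[ b < p ] (𝟙∤ b * 1)             ≡⟨ cong (p ^ e *_) (trans (∑-cong p (λ b _ → *-identityʳ (𝟙∤ b))) ∑𝟙∤) ⟩
    p ^ e * (p ∸ 1)                          ∎
    where open ≡-Reasoning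

  dvdCases : ℕ × ℕ → ℤ → ℕ
  dvdCases (X , Y) c = select (p ∣? ∣ c ∣) X Y

  dvdCases-shift : ∀ s c d → p ∣ ∣ d ∣ → dvdCases s (c ℤ.+ d) ≡ dvdCases s c
  dvdCases-shift (X , Y) c d p∣d = select-cong (p ∣? _) (p ∣? _) X Y
    (λ p∣c+d → ℤ∣.∣m+n∣n⇒∣m {p} {c} {d} p∣c+d p∣d) (λ p∣c → ℤ∣.∣m∣n⇒∣m+n {p} {c} {d} p∣c p∣d)

  dvdCases-periodic : ∀ s → Periodic p (dvdCases s)
  dvdCases-periodic s c k = dvdCases-shift s c (k ℤ.* + p) (ℤ∣.∣n*M k)

  infixr 7 _·_
  _·_ : ℕ → ℕ × ℕ → ℕ × ℕ
  k · (X , Y) = k * X , k * Y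

  *-dvdCases : ∀ k s c → k * dvdCases s c ≡ dvdCases (k · s) c
  *-dvdCases k (X , Y) c with p ∣? ∣ c ∣
  ... | yes _ = refl
  ... | no _  = refl

  -- If p ∣ a, the class of c + a b is that of c. If p ∤ a, then as b runs over the p - 1 units,
  -- c + a b is divisible by p for no b when p ∣ c, and for exactly one b when p ∤ c.
  step : ∀ {ℓ} {P : Set ℓ} → Dec P → ℕ × ℕ → ℕ × ℕ
  step (yes _) s       = (p ∸ 1) · s
  step (no _)  (X , Y) = (p ∸ 1) * Y , X + (p ∸ 2) * Y

  stepBy : ℤ → ℕ × ℕ → ℕ × ℕ
  stepBy a = step (p ∣? ∣ a ∣)

  step-· : ∀ {ℓ} {P : Set ℓ} (d : Dec P) k s → step d (k · s) ≡ k · step d s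
  step-· (yes _) k (X , Y) = cong₂ _,_ (*-left-comm (p ∸ 1) k X) (*-left-comm (p ∸ 1) k Y)
  step-· (no _)  k (X , Y) = cong₂ _,_ (*-left-comm (p ∸ 1) k Y)
    (trans (cong (λ n → k * X + n) (*-left-comm (p ∸ 2) k Y)) (sym (*-distribˡ-+ k X ((p ∸ 2) * Y))))

  ∑-dvdCases : ∀ a s c → ∑[ b < p ] (𝟙∤ b * dvdCases s (c ℤ.+ a ℤ.* + b)) ≡ dvdCases (stepBy a s) c
  ∑-dvdCases a s c with p ∣? ∣ a ∣
  ... | yes p∣a = begin
    ∑[ b < p ] (𝟙∤ b * dvdCases s (c ℤ.+ a ℤ.* + b))
      ≡⟨ ∑-cong p (λ b _ → cong (𝟙∤ b *_) (dvdCases-shift s c _ (ℤ∣.∣m⇒∣m*n {p} {a} (+ b) p∣a))) ⟩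
    ∑[ b < p ] (𝟙∤ b * dvdCases s c)                  ≡⟨ ∑-*ʳ p (dvdCases s c) 𝟙∤ ⟩
    ∑< p 𝟙∤ * dvdCases s c                            ≡⟨ cong (_* dvdCases s c) ∑𝟙∤ ⟩
    (p ∸ 1) * dvdCases s c                            ≡⟨ *-dvdCases (p ∸ 1) s c ⟩
    dvdCases ((p ∸ 1) · s) c                          ∎
    where open ≡-Reasoning
  ... | no p∤a = ∑-dvdCases-∤ s (p ∣? ∣ c ∣)
    where
    open ≡-Reasoning
    lin : ℕ → ℤ
    lin b = c ℤ.+ a ℤ.* + b
    p∤ab : ∀ {b} → ¬ p ∣ b → ¬ p ∣ ∣ a ℤ.* + b ∣
    p∤ab p∤b p∣ab with ∣*⇒∣⊎∣ a (+ _) p∣ab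
    ... | inj₁ p∣a = p∤a p∣a
    ... | inj₂ p∣b = p∤b p∣b
    ∑-dvdCases-∤ : ∀ s → (p∣c? : Dec (p ∣ ∣ c ∣)) →
                   ∑[ b < p ] (𝟙∤ b * dvdCases s (lin b)) ≡ select p∣c? ((p ∸ 1) * proj₂ s) (proj₁ s + (p ∸ 2) * proj₂ s)
    ∑-dvdCases-∤ (X , Y) (yes p∣c) = begin
      ∑[ b < p ] (𝟙∤ b * dvdCases (X , Y) (lin b)) ≡⟨ ∑-cong p (λ b _ → only-Y b) ⟩
      ∑[ b < p ] (𝟙∤ b * Y)                         ≡⟨ ∑-*ʳ p Y 𝟙∤ ⟩
      ∑< p 𝟙∤ * Y                                   ≡⟨ cong (_* Y) ∑𝟙∤ ⟩
      (p ∸ 1) * Y                                   ∎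
      where
      only-Y : ∀ b → 𝟙∤ b * dvdCases (X , Y) (lin b) ≡ 𝟙∤ b * Y
      only-Y b with p ∣? b
      ... | yes _  = refl
      ... | no p∤b = cong (1 *_) (select-cong (p ∣? _) (no (λ ())) X Y
                       (λ p∣lin → p∤ab p∤b (ℤ∣.∣m+n∣m⇒∣n {p} {c} p∣lin p∣c)) λ ())
    ∑-dvdCases-∤ (X , Y) (no p∤c) = begin
      ∑[ b < p ] (𝟙∤ b * dvdCases (X , Y) (lin b))  ≡⟨ ∑-cong p (λ b _ → split b) ⟩
      ∑[ b < p ] (sol b * X + other b * Y)          ≡⟨ ∑-distrib-+ p _ _ ⟩
      ∑[ b < p ] (sol b * X) + ∑[ b < p ] (other b * Y) ≡⟨ cong₂ _+_ (trans (∑-*ʳ p X sol) (cong (_* X) ∑sol≡1))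
                                                                     (trans (∑-*ʳ p Y other) (cong (_* Y) ∑other)) ⟩
      1 * X + (p ∸ 2) * Y                           ≡⟨ cong (_+ (p ∸ 2) * Y) (*-identityˡ X) ⟩
      X + (p ∸ 2) * Y                               ∎
      where
      sol other : ℕ → ℕ
      sol   b = 𝟙∤ b * 𝟙[ p ∣ lin b ]
      other b = 𝟙∤ b * 𝟙 (¬? (p ∣? ∣ lin b ∣))
      split : ∀ b → 𝟙∤ b * dvdCases (X , Y) (lin b) ≡ sol b * X + other b * Y
      split b = begin
        𝟙∤ b * select (p ∣? _) X Y
          ≡⟨ cong (𝟙∤ b *_) (select≡𝟙 (p ∣? _) X Y) ⟩
        𝟙∤ b * (𝟙[ p ∣ lin b ] * X + 𝟙 (¬? (p ∣? _)) * Y)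
          ≡⟨ *-distribˡ-+ (𝟙∤ b) _ _ ⟩
        𝟙∤ b * (𝟙[ p ∣ lin b ] * X) + 𝟙∤ b * (𝟙 (¬? (p ∣? _)) * Y)
          ≡⟨ sym (cong₂ _+_ (*-assoc (𝟙∤ b) _ X) (*-assoc (𝟙∤ b) _ Y)) ⟩
        sol b * X + other b * Y ∎
      -- a solution of p ∣ c + a b is automatically a unit, since p ∤ c
      sol≡ : ∀ b → sol b ≡ 𝟙[ p ∣ lin b ]
      sol≡ b with p ∣? ∣ lin b ∣
      ... | no _      = *-zeroʳ (𝟙∤ b)
      ... | yes p∣lin = cong (_* 1) (𝟙-yes (¬? (p ∣? b))
                          (λ p∣b → p∤c (ℤ∣.∣m+n∣n⇒∣m {p} {c} p∣lin (ℤ∣.∣n⇒∣m*n a {+ b} p∣b))))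
      ∑sol≡1 : ∑< p sol ≡ 1
      ∑sol≡1 = trans (∑-cong p (λ b _ → sol≡ b)) (linear-congruence p a c (Coprime.sym (∤⇒coprime p∤a)))
      sol+other : ∀ b → sol b + other b ≡ 𝟙∤ b
      sol+other b = trans (sym (*-distribˡ-+ (𝟙∤ b) _ _))
                          (trans (cong (𝟙∤ b *_) (𝟙+𝟙¬≡1 (p ∣? _))) (*-identityʳ (𝟙∤ b)))
      ∑other : ∑< p other ≡ p ∸ 2
      ∑other = begin
        ∑< p other                  ≡⟨ sym (m+n∸m≡n 1 (∑< p other)) ⟩
        1 + ∑< p other ∸ 1          ≡⟨ cong (λ n → n + ∑< p other ∸ 1) (sym ∑sol≡1) ⟩
        ∑< p sol + ∑< p other ∸ 1   ≡⟨ cong (_∸ 1) (sym (∑-distrib-+ p sol other)) ⟩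
        ∑[ b < p ] (sol b + other b) ∸ 1 ≡⟨ cong (_∸ 1) (trans (∑-cong p (λ b _ → sol+other b)) ∑𝟙∤) ⟩
        p ∸ 1 ∸ 1                   ≡⟨ ∸-+-assoc p 1 1 ⟩
        p ∸ 2                       ∎

  conv-dvdCases : ∀ e a s c → conv (p ^ suc e) a (dvdCases s) c ≡ dvdCases (p ^ e · stepBy a s) c
  conv-dvdCases e a s c = begin
    conv (p ^ suc e) a (dvdCases s) c                              ≡⟨ conv-p^ e a (dvdCases-periodic s) c ⟩
    p ^ e * ∑[ b < p ] (𝟙∤ b * dvdCases s (c ℤ.+ a ℤ.* + b))      ≡⟨ cong (p ^ e *_) (∑-dvdCases a s c) ⟩
    p ^ e * dvdCases (stepBy a s) c                                ≡⟨ *-dvdCases (p ^ e) (stepBy a s) c ⟩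
    dvdCases (p ^ e · stepBy a s) c                                ∎
    where open ≡-Reasoning

  conv³-dvdCases : ∀ e x y z s c → let Q = p ^ suc e; m = p ^ e in
                   conv Q x (conv Q y (conv Q z (dvdCases s))) c ≡
                   dvdCases (m · (m · (m · stepBy x (stepBy y (stepBy z s))))) c
  conv³-dvdCases e x y z s c = begin
    conv Q x (conv Q y (conv Q z (dvdCases s))) c
      ≡⟨ conv-cong Q x (conv-cong Q y (conv-dvdCases e z s)) c ⟩
    conv Q x (conv Q y (dvdCases (m · stepBy z s))) c
      ≡⟨ conv-cong Q x (conv-dvdCases e y _) c ⟩
    conv Q x (dvdCases (m · stepBy y (m · stepBy z s))) c
      ≡⟨ conv-dvdCases e x _ c ⟩
    dvdCases (m · stepBy x (m · stepBy y (m · stepBy z s))) c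
      ≡⟨ cong (λ t → dvdCases (m · stepBy x (m · t)) c) (step-· (p ∣? _) m _) ⟩
    dvdCases (m · stepBy x (m · (m · stepBy y (stepBy z s)))) c
      ≡⟨ cong (λ t → dvdCases (m · t) c) (trans (step-· (p ∣? _) m _) (cong (m ·_) (step-· (p ∣? _) m _))) ⟩
    dvdCases (m · (m · (m · stepBy x (stepBy y (stepBy z s))))) c ∎
    where
    open ≡-Reasoning
    Q = p ^ suc e
    m = p ^ e

  -- Summing out a coordinate u with p ∤ u: c + u b ≡ 0 (mod Q) has exactly one solution b,
  -- and it is a unit precisely when p ∤ c.
  conv-𝟙∣ : ∀ e u → ¬ p ∣ ∣ u ∣ → ∀ c → conv (p ^ suc e) u 𝟙[ p ^ suc e ∣_] c ≡ dvdCases (0 , 1) c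
  conv-𝟙∣ e u p∤u c with p ∣? ∣ c ∣
  ... | yes p∣c = ∑-zeros Q (λ b _ →
    𝟙-× (coprime? b Q) (Q ∣? _) (no (λ ())) (λ b⊥Q Q∣lin → coprime-p^⁻ e b⊥Q (p∣b Q∣lin)) λ ())
    where
    Q = p ^ suc e
    p∣b : ∀ {b} → Q ∣ ∣ c ℤ.+ u ℤ.* + b ∣ → p ∣ b
    p∣b {b} Q∣lin with ∣*⇒∣⊎∣ u (+ b) (ℤ∣.∣m+n∣m⇒∣n {p} {c} (ℕ∣.∣-trans (ℕ∣.m∣m*n (p ^ e)) Q∣lin) p∣c)
    ... | inj₁ p∣u = ⊥-elim (p∤u p∣u)
    ... | inj₂ p∣b = p∣b
  ... | no p∤c = trans (∑-cong Q (λ b _ → unit-automatic b))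
    (linear-congruence Q {{p^≢0 {suc e}}} u c (Coprime.sym (coprime-^ (suc e) (∤⇒coprime p∤u))))
    where
    Q = p ^ suc e
    unit-automatic : ∀ b → 𝟙 (coprime? b Q) * 𝟙[ Q ∣ c ℤ.+ u ℤ.* + b ] ≡ 𝟙[ Q ∣ c ℤ.+ u ℤ.* + b ]
    unit-automatic b with Q ∣? ∣ c ℤ.+ u ℤ.* + b ∣
    ... | no _      = *-zeroʳ (𝟙 (coprime? b Q))
    ... | yes Q∣lin = cong (_* 1) (𝟙-yes (coprime? b Q) (coprime-p^⁺ e (λ p∣b →
      p∤c (ℤ∣.∣m+n∣n⇒∣m {p} {c} (ℕ∣.∣-trans (ℕ∣.m∣m*n (p ^ e)) Q∣lin) (ℤ∣.∣n⇒∣m*n u {+ b} p∣b)))))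

  dvdCases-0 : ∀ s → dvdCases s (+ 0) ≡ proj₁ s
  dvdCases-0 (X , Y) with p ∣? 0
  ... | yes _  = refl
  ... | no p∤0 = ⊥-elim (p∤0 (p ℕ∣.∣0))

  -- solCountAt with the coordinates reordered so that the last one, u, is a unit mod p.
  record UnitReduction (a : Vec4) : Set where
    field
      x y z u : ℤ
      p∤u : ¬ p ∣ ∣ u ∣
      solCountAt≡ : ∀ e c → let Q = p ^ suc e in
                    solCountAt a Q c ≡ conv Q x (conv Q y (conv Q z (conv Q u 𝟙[ Q ∣_]))) c

  module _ (a : Vec4) where
    private
      a₀ = a i₀
      a₁ = a i₁
      a₂ = a i₂
      a₃ = a i₃

    unitReduction : gcd4 a ≡ 1 → UnitReduction a
    unitReduction gcd≡1 with p ∣? ∣ a₃ ∣ | p ∣? ∣ a₂ ∣ | p ∣? ∣ a₁ ∣ | p ∣? ∣ a₀ ∣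
    ... | no p∤a₃ | _       | _       | _       = record
      { x = a₀ ; y = a₁ ; z = a₂ ; u = a₃ ; p∤u = p∤a₃ ; solCountAt≡ = λ e c → refl }
    ... | yes _   | no p∤a₂ | _       | _       = record
      { x = a₀ ; y = a₁ ; z = a₃ ; u = a₂ ; p∤u = p∤a₂
      ; solCountAt≡ = λ e → let Q = p ^ suc e in
          conv-cong Q a₀ (conv-cong Q a₁ (conv-comm Q a₂ a₃ 𝟙[ Q ∣_])) }
    ... | yes _   | yes _   | no p∤a₁ | _       = record
      { x = a₀ ; y = a₂ ; z = a₃ ; u = a₁ ; p∤u = p∤a₁
      ; solCountAt≡ = λ e → let Q = p ^ suc e in
          conv-cong Q a₀ (λ c → trans (conv-comm Q a₁ a₂ (conv Q a₃ 𝟙[ Q ∣_]) c)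
                                       (conv-cong Q a₂ (conv-comm Q a₁ a₃ 𝟙[ Q ∣_]) c)) }
    ... | yes _   | yes _   | yes _   | no p∤a₀ = record
      { x = a₁ ; y = a₂ ; z = a₃ ; u = a₀ ; p∤u = p∤a₀
      ; solCountAt≡ = λ e c → let Q = p ^ suc e in
          trans (conv-comm Q a₀ a₁ (conv Q a₂ (conv Q a₃ 𝟙[ Q ∣_])) c) (conv-cong Q a₁ (λ c′ →
            trans (conv-comm Q a₀ a₂ (conv Q a₃ 𝟙[ Q ∣_]) c′) (conv-cong Q a₂ (conv-comm Q a₀ a₃ 𝟙[ Q ∣_]) c′)) c) }
    ... | yes p∣a₃ | yes p∣a₂ | yes p∣a₁ | yes p∣a₀ =
      ⊥-elim (p∤1 (subst (p ∣_) gcd≡1 (gcd-greatest p∣a₀ (gcd-greatest p∣a₁ (gcd-greatest p∣a₂ p∣a₃)))))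

  p∸1≡1+[p∸2] : p ∸ 1 ≡ suc (p ∸ 2)
  p∸1≡1+[p∸2] = ∸1≡1+∸2 1<p

  -- The value V after three steps, with q = p - 1 = suc r, depending on how many of the three
  -- coefficients are units mod p; each is compared with r q².
  private
    no-unit : ∀ r → suc r * (suc r * (suc r * 0)) ≡ 0
    no-unit = ℕ-Solver.solve-∀

    one-unit : ∀ r → r * suc r * suc r + suc r * suc r ≡ suc r * (suc r * (suc r * 1))
    one-unit = ℕ-Solver.solve-∀

    two-units : ∀ r → r * suc r * suc r + 0 ≡ suc r * (suc r * (r * 1))
    two-units = ℕ-Solver.solve-∀

    two-units′ : ∀ r → r * suc r * suc r + 0 ≡ suc r * (suc r * 0 + r * (suc r * 1))
    two-units′ = ℕ-Solver.solve-∀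

    three-units : ∀ r → r * suc r * suc r + suc r ≡ suc r * (suc r * 1 + r * (r * 1))
    three-units = ℕ-Solver.solve-∀

  three-steps-bound : ∀ {ℓ₁ ℓ₂ ℓ₃} {P₁ : Set ℓ₁} {P₂ : Set ℓ₂} {P₃ : Set ℓ₃}
                      (d₁ : Dec P₁) (d₂ : Dec P₂) (d₃ : Dec P₃) →
                      let V = proj₁ (step d₁ (step d₂ (step d₃ (0 , 1)))) in
                      1 ≤ V → (p ∸ 2) * (p ∸ 1) * (p ∸ 1) ≤ V
  three-steps-bound (yes _) (yes _) (yes _) 1≤V rewrite p∸1≡1+[p∸2] = ⊥-elim (<-irrefl (sym (no-unit (p ∸ 2))) 1≤V)
  three-steps-bound (yes _) (yes _) (no _)  _ rewrite p∸1≡1+[p∸2] = ≤-of-+ (one-unit (p ∸ 2))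
  three-steps-bound (yes _) (no _)  (yes _) _ rewrite p∸1≡1+[p∸2] = ≤-of-+ (one-unit (p ∸ 2))
  three-steps-bound (no _)  (yes _) (yes _) _ rewrite p∸1≡1+[p∸2] = ≤-of-+ (one-unit (p ∸ 2))
  three-steps-bound (yes _) (no _)  (no _)  _ rewrite p∸1≡1+[p∸2] = ≤-of-+ (two-units (p ∸ 2))
  three-steps-bound (no _)  (yes _) (no _)  _ rewrite p∸1≡1+[p∸2] = ≤-of-+ (two-units (p ∸ 2))
  three-steps-bound (no _)  (no _)  (yes _) _ rewrite p∸1≡1+[p∸2] = ≤-of-+ (two-units′ (p ∸ 2))
  three-steps-bound (no _)  (no _)  (no _)  _ rewrite p∸1≡1+[p∸2] = ≤-of-+ (three-units (p ∸ 2))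

  module _ (a : Vec4) (gcd≡1 : gcd4 a ≡ 1) where
    open UnitReduction (unitReduction a gcd≡1)

    private
      V : ℕ
      V = proj₁ (stepBy x (stepBy y (stepBy z (0 , 1))))

      solCount-p^≡ : ∀ e → solCount a (p ^ suc e) ≡ p ^ e * (p ^ e * (p ^ e * V))
      solCount-p^≡ e = begin
        solCount a Q                                                 ≡⟨ solCount≡solCountAt a Q ⟩
        solCountAt a Q (+ 0)                                         ≡⟨ solCountAt≡ e (+ 0) ⟩
        conv Q x (conv Q y (conv Q z (conv Q u 𝟙[ Q ∣_]))) (+ 0)
          ≡⟨ conv-cong Q x (conv-cong Q y (conv-cong Q z (conv-𝟙∣ e u p∤u))) (+ 0) ⟩
        conv Q x (conv Q y (conv Q z (dvdCases (0 , 1)))) (+ 0)      ≡⟨ conv³-dvdCases e x y z (0 , 1) (+ 0) ⟩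
        dvdCases (m · (m · (m · stepBy x (stepBy y (stepBy z (0 , 1)))))) (+ 0) ≡⟨ dvdCases-0 _ ⟩
        m * (m * (m * V))                                            ∎
        where
        open ≡-Reasoning
        Q = p ^ suc e
        m = p ^ e

      solCount-p≡V : solCount a p ≡ V
      solCount-p≡V = begin
        solCount a p             ≡⟨ cong (solCount a) (sym (*-identityʳ p)) ⟩
        solCount a (p ^ 1)       ≡⟨ solCount-p^≡ 0 ⟩
        1 * (1 * (1 * V))        ≡⟨ trans (*-identityˡ _) (trans (*-identityˡ _) (*-identityˡ V)) ⟩
        V                        ∎
        where open ≡-Reasoning

    solCount-lift : ∀ e → solCount a (p ^ suc e) ≡ p ^ e * (p ^ e * (p ^ e * solCount a p))
    solCount-lift e = trans (solCount-p^≡ e) (cong (λ n → p ^ e * (p ^ e * (p ^ e * n))) (sym solCount-p≡V))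

    solCount-p-bound : 1 ≤ solCount a p → (p ∸ 2) * (p ∸ 1) * (p ∸ 1) ≤ solCount a p
    solCount-p-bound 1≤N = subst (_ ≤_) (sym solCount-p≡V)
      (three-steps-bound (p ∣? ∣ x ∣) (p ∣? ∣ y ∣) (p ∣? ∣ z ∣) (subst (1 ≤_) solCount-p≡V 1≤N))

  -- Reducing a local solution x mod p gives a tuple of units b with p ∣ a·b.
  local⇒solCount≥1 : ∀ a → LocalAt p a → 1 ≤ solCount a p
  local⇒solCount≥1 a (x , p∤x , p∣ax) = subst (1 ≤_) (sym (solCount≡solCountAt a p))
    (∑ᵘ-pos p (b<p i₀) (b⊥p i₀) (∑ᵘ-pos p (b<p i₁) (b⊥p i₁)
      (∑ᵘ-pos p (b<p i₂) (b⊥p i₂) (∑ᵘ-pos p (b<p i₃) (b⊥p i₃) (≤-reflexive (sym (𝟙-yes (p ∣? _) p∣a·b)))))))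
    where
    b : Fin 4 → ℕ
    b i = x i ℤ.%ℕ p
    q : Fin 4 → ℤ
    q i = x i ℤ./ℕ p
    b<p : ∀ i → b i < p
    b<p i = n%ℕd<d (x i) p
    x≡ : ∀ i → x i ≡ + b i ℤ.+ q i ℤ.* + p
    x≡ i = a≡a%ℕn+[a/ℕn]*n (x i) p
    b⊥p : ∀ i → Coprime (b i) p
    b⊥p i = ∤⇒coprime (λ p∣b → p∤x i (subst (λ n → p ∣ ∣ n ∣) (sym (x≡ i))
              (ℤ∣.∣m∣n⇒∣m+n {p} {+ b i} {q i ℤ.* + p} p∣b (ℤ∣.∣n*M (q i)))))
    a·b k : ℤ
    a·b = + 0 ℤ.+ a i₀ ℤ.* + b i₀ ℤ.+ a i₁ ℤ.* + b i₁ ℤ.+ a i₂ ℤ.* + b i₂ ℤ.+ a i₃ ℤ.* + b i₃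
    k   = a i₀ ℤ.* q i₀ ℤ.+ a i₁ ℤ.* q i₁ ℤ.+ a i₂ ℤ.* q i₂ ℤ.+ a i₃ ℤ.* q i₃
    expand : ∀ a₀ a₁ a₂ a₃ b₀ b₁ b₂ b₃ q₀ q₁ q₂ q₃ m →
      a₀ ℤ.* (b₀ ℤ.+ q₀ ℤ.* m) ℤ.+ (a₁ ℤ.* (b₁ ℤ.+ q₁ ℤ.* m) ℤ.+
        (a₂ ℤ.* (b₂ ℤ.+ q₂ ℤ.* m) ℤ.+ a₃ ℤ.* (b₃ ℤ.+ q₃ ℤ.* m)))
      ≡ (+ 0 ℤ.+ a₀ ℤ.* b₀ ℤ.+ a₁ ℤ.* b₁ ℤ.+ a₂ ℤ.* b₂ ℤ.+ a₃ ℤ.* b₃) ℤ.+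
        (a₀ ℤ.* q₀ ℤ.+ a₁ ℤ.* q₁ ℤ.+ a₂ ℤ.* q₂ ℤ.+ a₃ ℤ.* q₃) ℤ.* m
    expand = ℤ-Solver.solve-∀
    a·x≡ : dot a x ≡ a·b ℤ.+ k ℤ.* + p
    a·x≡ = trans (cong₂ ℤ._+_ (cong (a i₀ ℤ.*_) (x≡ i₀)) (cong₂ ℤ._+_ (cong (a i₁ ℤ.*_) (x≡ i₁))
                   (cong₂ ℤ._+_ (cong (a i₂ ℤ.*_) (x≡ i₂)) (cong (a i₃ ℤ.*_) (x≡ i₃)))))
                 (expand (a i₀) (a i₁) (a i₂) (a i₃) (+ b i₀) (+ b i₁) (+ b i₂) (+ b i₃) (q i₀) (q i₁) (q i₂) (q i₃) (+ p))
    p∣a·b : p ∣ ∣ a·b ∣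
    p∣a·b = ℤ∣.∣m+n∣n⇒∣m {p} {a·b} (subst (λ n → p ∣ ∣ n ∣) a·x≡ p∣ax) (ℤ∣.∣n*M k)

-- Lower bounds for σ

-- The inequality v / u ≤ σ a Q, cross-multiplied.
record σ≥ (a : Vec4) (v u Q : ℕ) : Set where
  constructor cross-multiplied
  field
    cross : v * φ Q ^ 4 ≤ u * (Q * solCount a Q)

open σ≥


σ≥-* : ∀ a {v u v′ u′} R Q .{{_ : NonZero Q}} .{{_ : NonZero R}} → Coprime R Q →
       σ≥ a v u R → σ≥ a v′ u′ Q → σ≥ a (v * v′) (u * u′) (R * Q)
σ≥-* a {v} {u} {v′} {u′} R Q R⊥Q σ≥R σ≥Q = cross-multiplied (begin
  v * v′ * φ (R * Q) ^ 4                       ≡⟨ cong (λ n → v * v′ * n ^ 4) (φ-* R Q R⊥Q) ⟩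
  v * v′ * (φ Q * φ R) ^ 4                     ≡⟨ split-φ v v′ (φ R) (φ Q) ⟩
  (v * φ R ^ 4) * (v′ * φ Q ^ 4)               ≤⟨ *-mono-≤ (cross σ≥R) (cross σ≥Q) ⟩
  (u * (R * solCount a R)) * (u′ * (Q * solCount a Q)) ≡⟨ join-N u u′ R Q (solCount a R) (solCount a Q) ⟩
  u * u′ * (R * Q * (solCount a Q * solCount a R)) ≡⟨ cong (λ n → u * u′ * (R * Q * n)) (sym (solCount-* a R Q R⊥Q)) ⟩
  u * u′ * (R * Q * solCount a (R * Q))        ∎)
  where
  open ≤-Reasoning
  -- x ^ 4 unfolded to x * (x * (x * (x * 1))), the form the ring solver handles
  split-φ : ∀ v v′ x y → v * v′ * ((y * x) * ((y * x) * ((y * x) * ((y * x) * 1))))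
                       ≡ (v * (x * (x * (x * (x * 1))))) * (v′ * (y * (y * (y * (y * 1)))))
  split-φ = ℕ-Solver.solve-∀
  join-N : ∀ u u′ R Q s t → (u * (R * s)) * (u′ * (Q * t)) ≡ u * u′ * (R * Q * (t * s))
  join-N = ℕ-Solver.solve-∀

σ≥-weaken : ∀ a {v u v′ u′} Q .{{_ : NonZero u}} → v′ * u ≤ v * u′ → σ≥ a v u Q → σ≥ a v′ u′ Q
σ≥-weaken a {v} {u} {v′} {u′} Q v′/u′≤v/u σ≥Q = cross-multiplied (*-cancelˡ-≤ u (begin
  u * (v′ * φQ⁴)   ≡⟨ *-left-comm u v′ φQ⁴ ⟩
  v′ * (u * φQ⁴)   ≡⟨ sym (*-assoc v′ u φQ⁴) ⟩
  v′ * u * φQ⁴     ≤⟨ *-monoˡ-≤ φQ⁴ v′/u′≤v/u ⟩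
  v * u′ * φQ⁴     ≡⟨ trans (cong (_* φQ⁴) (*-comm v u′)) (*-assoc u′ v φQ⁴) ⟩
  u′ * (v * φQ⁴)   ≤⟨ *-monoʳ-≤ u′ (cross σ≥Q) ⟩
  u′ * (u * QN)    ≡⟨ *-left-comm u′ u QN ⟩
  u * (u′ * QN)    ∎))
  where
  open ≤-Reasoning
  φQ⁴ = φ Q ^ 4
  QN = Q * solCount a Q

module _ (p : ℕ) (p-prime : Prime p) where
  open PrimePower p p-prime

  σ≥-p^ : ∀ a → gcd4 a ≡ 1 → ∀ e → σ≥ a (p * solCount a p) ((p ∸ 1) ^ 4) (p ^ suc e)
  σ≥-p^ a gcd≡1 e = cross-multiplied (≤-reflexive (begin
    p * N * φ (p ^ suc e) ^ 4                             ≡⟨ cong (λ n → p * N * n ^ 4) (φ-p^ e) ⟩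
    p * N * (p ^ e * (p ∸ 1)) ^ 4                         ≡⟨ balance p N (p ^ e) (p ∸ 1) ⟩
    (p ∸ 1) ^ 4 * (p ^ suc e * (p ^ e * (p ^ e * (p ^ e * N))))
      ≡⟨ cong (λ n → (p ∸ 1) ^ 4 * (p ^ suc e * n)) (sym (solCount-lift a gcd≡1 e)) ⟩
    (p ∸ 1) ^ 4 * (p ^ suc e * solCount a (p ^ suc e))    ∎))
    where
    open ≡-Reasoning
    N = solCount a p
    balance : ∀ p N m q → p * N * ((m * q) * ((m * q) * ((m * q) * ((m * q) * 1))))
                        ≡ q * (q * (q * (q * 1))) * ((p * m) * (m * (m * (m * N))))
    balance = ℕ-Solver.solve-∀

  instance
    [p∸1]^4≢0 : NonZero ((p ∸ 1) ^ 4)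
    [p∸1]^4≢0 = m^n≢0 (p ∸ 1) 4 {{ℕ.>-nonZero (m<n⇒0<n∸m 1<p)}}

  -- p (p - 2) / (p - 1)² = 1 - 1/(p - 1)²; local solubility enters here, through N(p) ≥ 1.
  σ≥-p^-local : ∀ a → gcd4 a ≡ 1 → LocalAt p a → ∀ e → σ≥ a (p * (p ∸ 2)) ((p ∸ 1) * (p ∸ 1)) (p ^ suc e)
  σ≥-p^-local a gcd≡1 local e = σ≥-weaken a (p ^ suc e) (begin
    p * (p ∸ 2) * (p ∸ 1) ^ 4                       ≡⟨ regroup p (p ∸ 2) (p ∸ 1) ⟩
    p * ((p ∸ 2) * (p ∸ 1) * (p ∸ 1)) * ((p ∸ 1) * (p ∸ 1)) ≤⟨ *-monoˡ-≤ ((p ∸ 1) * (p ∸ 1)) (*-monoʳ-≤ p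
                                                                 (solCount-p-bound a gcd≡1 (local⇒solCount≥1 a local))) ⟩
    p * solCount a p * ((p ∸ 1) * (p ∸ 1))          ∎) (σ≥-p^ a gcd≡1 e)
    where
    open ≤-Reasoning
    regroup : ∀ p r q → p * r * (q * (q * (q * (q * 1)))) ≡ p * (r * q * q) * (q * q)
    regroup = ℕ-Solver.solve-∀

  σ≥-p^-weak : ∀ a → gcd4 a ≡ 1 → LocalAt p a → ∀ e → σ≥ a p ((p ∸ 1) ^ 4) (p ^ suc e)
  σ≥-p^-weak a gcd≡1 local e = σ≥-weaken a (p ^ suc e)
    (*-monoˡ-≤ ((p ∸ 1) ^ 4) (subst (_≤ p * solCount a p) (*-identityʳ p) (*-monoʳ-≤ p (local⇒solCount≥1 a local))))
    (σ≥-p^ a gcd≡1 e)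

-- The modulus W

∣^⇒∣ : ∀ {p} x n → Prime p → p ∣ x ^ n → p ∣ x
∣^⇒∣ x zero    p-prime p∣1 = ⊥-elim (PrimePower.p∤1 _ p-prime p∣1)
∣^⇒∣ x (suc n) p-prime p∣x^n with euclidsLemma x (x ^ n) p-prime p∣x^n
... | inj₁ p∣x   = p∣x
... | inj₂ p∣x^n = ∣^⇒∣ x n p-prime p∣x^n

module _ (m : ℕ) where

  private
    f : ℕ → ℕ
    f p = p ^ (ceilLog p m + 1)

  Wfun-suc : ∀ n → Wfun (suc n) m ≡ Wfun n m * product (map f (filter prime? [ suc n ]))
  Wfun-suc n = begin
    product (map f (filter prime? (upTo (2 + n))))
      ≡⟨ cong (λ xs → product (map f (filter prime? xs))) (sym (upTo-∷ʳ (suc n))) ⟩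
    product (map f (filter prime? (upTo (suc n) ++ [ suc n ])))
      ≡⟨ cong (λ xs → product (map f xs)) (filter-++ prime? (upTo (suc n)) [ suc n ]) ⟩
    product (map f (filter prime? (upTo (suc n)) ++ filter prime? [ suc n ]))
      ≡⟨ cong product (map-++ f (filter prime? (upTo (suc n))) _) ⟩
    product (map f (filter prime? (upTo (suc n))) ++ map f (filter prime? [ suc n ]))
      ≡⟨ product-++ (map f (filter prime? (upTo (suc n)))) _ ⟩
    Wfun n m * product (map f (filter prime? [ suc n ])) ∎
    where open ≡-Reasoning

  Wfun-prime : ∀ n → Prime (suc n) → Wfun (suc n) m ≡ Wfun n m * suc n ^ suc (ceilLog (suc n) m)
  Wfun-prime n p-prime = trans (Wfun-suc n) (cong (Wfun n m *_) (begin
    product (map f (filter prime? [ suc n ])) ≡⟨ cong (λ xs → product (map f xs)) (filter-accept prime? {xs = []} p-prime) ⟩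
    f (suc n) * 1                             ≡⟨ *-identityʳ (f (suc n)) ⟩
    suc n ^ (ceilLog (suc n) m + 1)           ≡⟨ cong (suc n ^_) (+-comm (ceilLog (suc n) m) 1) ⟩
    suc n ^ suc (ceilLog (suc n) m)           ∎))
    where open ≡-Reasoning

  Wfun-nonprime : ∀ n → ¬ Prime (suc n) → Wfun (suc n) m ≡ Wfun n m
  Wfun-nonprime n ¬prime = trans (Wfun-suc n)
    (trans (cong (λ xs → Wfun n m * product (map f xs)) (filter-reject prime? {xs = []} ¬prime)) (*-identityʳ (Wfun n m)))

  Wfun-0 : Wfun 0 m ≡ 1
  Wfun-0 = cong (λ xs → product (map f xs)) (filter-reject prime? {xs = []} ¬prime[0])

  Wfun-1 : Wfun 1 m ≡ 1
  Wfun-1 = trans (Wfun-nonprime 0 ¬prime[1]) Wfun-0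

  Wfun≢0 : ∀ n → NonZero (Wfun n m)
  Wfun≢0 zero    = subst NonZero (sym Wfun-0) _
  Wfun≢0 (suc n) with prime? (suc n)
  ... | yes p-prime = subst NonZero (sym (Wfun-prime n p-prime))
                        (m*n≢0 (Wfun n m) _ {{Wfun≢0 n}} {{m^n≢0 (suc n) (suc (ceilLog (suc n) m))}})
  ... | no ¬prime   = subst NonZero (sym (Wfun-nonprime n ¬prime)) (Wfun≢0 n)

  prime∤Wfun : ∀ {p} n → Prime p → n < p → ¬ p ∣ Wfun n m
  prime∤Wfun {p} zero p-prime _ p∣W = PrimePower.p∤1 p p-prime (subst (p ∣_) Wfun-0 p∣W)
  prime∤Wfun {p} (suc n) p-prime n<p p∣W with prime? (suc n)
  ... | no ¬prime = prime∤Wfun n p-prime (<-trans (n<1+n n) n<p) (subst (p ∣_) (Wfun-nonprime n ¬prime) p∣W)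
  ... | yes q-prime with euclidsLemma (Wfun n m) (suc n ^ suc (ceilLog (suc n) m)) p-prime (subst (p ∣_) (Wfun-prime n q-prime) p∣W)
  ...   | inj₁ p∣W′ = prime∤Wfun n p-prime (<-trans (n<1+n n) n<p) p∣W′
  ...   | inj₂ p∣q^ = <⇒≱ n<p (ℕ∣.∣⇒≤ (∣^⇒∣ (suc n) (suc (ceilLog (suc n) m)) p-prime p∣q^))

  σ≥-Wfun-prime : ∀ a {v u v′ u′} n (p-prime : Prime (suc n)) → σ≥ a v u (Wfun n m) →
                  σ≥ a v′ u′ (suc n ^ suc (ceilLog (suc n) m)) → σ≥ a (v * v′) (u * u′) (Wfun (suc n) m)
  σ≥-Wfun-prime a n p-prime σ≥W σ≥p^ = subst (σ≥ a _ _) (sym (Wfun-prime n p-prime))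
    (σ≥-* a (Wfun n m) (suc n ^ suc (ceilLog (suc n) m))
      {{m^n≢0 (suc n) (suc (ceilLog (suc n) m))}} {{Wfun≢0 n}} W⊥p^ σ≥W σ≥p^)
    where
    W⊥p^ : Coprime (Wfun n m) (suc n ^ suc (ceilLog (suc n) m))
    W⊥p^ = PrimePower.coprime-p^⁺ (suc n) p-prime (ceilLog (suc n) m) (prime∤Wfun n p-prime ≤-refl)

  -- Each prime p ≥ 3 contributes a factor ≥ (p - 2) p / (p - 1)², and these telescope.
  σ≥-Wfun : ∀ a → Lloc a → ∀ k → σ≥ a (2 + k) (2 * (1 + k)) (Wfun (2 + k) m)
  σ≥-Wfun a ((_ , gcd≡1) , _ , local) zero =
    subst (σ≥ a 2 2) (sym W₂≡2^) (σ≥-weaken a (2 ^ suc (ceilLog 2 m)) (s≤s (s≤s z≤n))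
      (σ≥-p^-weak 2 prime[2] a gcd≡1 (local 2 prime[2]) (ceilLog 2 m)))
    where
    W₂≡2^ : Wfun 2 m ≡ 2 ^ suc (ceilLog 2 m)
    W₂≡2^ = trans (Wfun-prime 1 prime[2]) (trans (cong (_* 2 ^ suc (ceilLog 2 m)) Wfun-1) (*-identityˡ _))
  σ≥-Wfun a lloc@((_ , gcd≡1) , _ , local) (suc k) with prime? (3 + k)
  ... | yes p-prime = σ≥-weaken a (Wfun (3 + k) m) (≤-reflexive (telescope k))
        (σ≥-Wfun-prime a (2 + k) p-prime (σ≥-Wfun a lloc k)
          (σ≥-p^-local (3 + k) p-prime a gcd≡1 (local (3 + k) p-prime) (ceilLog (3 + k) m)))
    where
    telescope : ∀ k → (3 + k) * (2 * (1 + k) * ((2 + k) * (2 + k))) ≡ (2 + k) * ((3 + k) * (1 + k)) * (2 * (2 + k))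
    telescope = ℕ-Solver.solve-∀
  ... | no ¬prime = subst (σ≥ a _ _) (sym (Wfun-nonprime (2 + k) ¬prime))
        (σ≥-weaken a (Wfun (2 + k) m) (≤-of-+ (decrease k)) (σ≥-Wfun a lloc k))
    where
    decrease : ∀ k → (3 + k) * (2 * (1 + k)) + 2 ≡ (2 + k) * (2 * (2 + k))
    decrease = ℕ-Solver.solve-∀

  σ≥½-Wfun : ∀ a → Lloc a → ∀ n → 2 ≤ n → σ≥ a 1 2 (Wfun n m)
  σ≥½-Wfun a lloc (suc (suc k)) _ = σ≥-weaken a (Wfun (2 + k) m) (≤-of-+ (halve k)) (σ≥-Wfun a lloc k)
    where
    halve : ∀ k → 1 * (2 * (1 + k)) + 2 ≡ (2 + k) * 2
    halve = ℕ-Solver.solve-∀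
  σ≥½-Wfun a lloc (suc zero) (s≤s ())

φ>0 : ∀ Q .{{_ : NonZero Q}} → 0 < φ Q
φ>0 (suc zero)    = subst (1 ≤_) (sym (φ≡∑ᵘ1 1))
  (∑ᵘ-pos 1 {λ _ → 1} {b = 0} (s≤s z≤n) (Coprime.sym (Coprime.1-coprimeTo 0)) ≤-refl)
φ>0 (suc (suc n)) = subst (1 ≤_) (sym (φ≡∑ᵘ1 (2 + n)))
  (∑ᵘ-pos (2 + n) {λ _ → 1} {b = 1} (s≤s (s≤s z≤n)) (Coprime.1-coprimeTo _) ≤-refl)

½≤/ : ∀ X d → suc d ≤ 2 * X → ½ ℚ.≤ + X ℚ./ suc d
½≤/ X d 1+d≤2X = toℚᵘ-cancel-≤ (ℚᵘ.≤-respˡ-≃ (ℚᵘ.≃-sym (toℚᵘ-fromℚᵘ (mkℚᵘ (+ 1) 1)))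
  (ℚᵘ.≤-respʳ-≃ (ℚᵘ.≃-sym (toℚᵘ-fromℚᵘ (mkℚᵘ (+ X) d)))
    (*≤* (subst (+ (1 * suc d) ℤ.≤_) (ℤ.pos-* X 2) (ℤ.+≤+ (subst₂ _≤_ (sym (*-identityˡ (suc d))) (*-comm 2 X) 1+d≤2X))))))

σ≥½⇒½≤σ : ∀ a Q → 0 < φ Q → σ≥ a 1 2 Q → ½ ℚ.≤ σ a Q
σ≥½⇒½≤σ a Q φ>0 (cross-multiplied cross) with φ Q ^ 4 | m^n>0 (φ Q) {{ℕ.>-nonZero φ>0}} 4
... | suc d | _ = ½≤/ (Q * solCount a Q) d (subst (_≤ 2 * (Q * solCount a Q)) (+-identityʳ (suc d)) cross)

-- σ(a, p^k) does not depend on k ≥ 1.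
lemma5p4 : Σ ℚ λ C → (0ℚ ℚ.< C) ×
           ((a : Vec4) → Lloc a → Σ ℕ λ n₀ → (n : ℕ) → n₀ ≤ n → (m : ℕ) → (m ≡ n ⊎ m ≡ suc n) →
             C ℚ.≤ σ a (Wfun n m))
lemma5p4 = ½ , ℚ.*<* (ℤ.+<+ (s≤s z≤n)) , λ a lloc → 2 , λ n 2≤n m _ →
  σ≥½⇒½≤σ a (Wfun n m) (φ>0 (Wfun n m) {{Wfun≢0 m n}}) (σ≥½-Wfun m a lloc n 2≤n)
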